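{- Let $d\ge -1$ and let $G$ be a finite simple graph in the class $\mathcal{X}_d$. Then the Whitney complex of $G$ is Dehn-Sommerville; equivalently, $f_G(t)+(-1)^d f_G(-1-t)=0$ for all $t$.
   Context: For a finite simple graph $G$, its Whitney complex is the set of vertex sets of its nonempty complete subgraphs; $f_k(G)$ is the number of complete subgraphs with $k+1$ vertices, $f_G(t)=1+\sum_{k\ge0} f_k(G)t^{k+1}$, and $\chi(G)=\sum_{k\ge0}(-1)^kf_k(G)$. For a vertex $x$, the unit sphere $S(x)$ is the subgraph induced by the neighbors of $x$. The classes $\mathcal{X}_d$ are defined inductively: $\mathcal{X}_{ -1}$ consists only of the empty graph; for $d\ge0$, $G\in\mathcal{X}_d$ iff $\chi(G)=1+(-1)^d$ and $S(x)\in\mathcal{X}_{d-1}$ for every vertex $x$ of $G$. For a complex of dimension $d$ (largest $k$ with $f_k\ne0$), the $h$-vector is given by $h_G(x)=(x-1)^{d+1}f_G(1/(x-1))=\sum_{i=0}^{d+1}h_ix^i$, and the complex is Dehn-Sommerville if $h_i=h_{d+1-i}$ for all $i$. -}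

module Defs where

open import Data.Nat as ℕ using (ℕ; zero; suc; _≡ᵇ_)
open import Data.Integer as ℤ using (ℤ; +_; -[1+_]; _+_; _*_; -_)
open import Data.Bool using (Bool; true; false; _∧_; _∨_; not; if_then_else_)
open import Data.Fin as Fin using (Fin)
open import Data.Fin.Subset using (Subset; ∣_∣; _∩_)
open import Data.Vec using (Vec; []; _∷_; lookup; tabulate)
open import Data.List as List using (List; []; _∷_; _++_; map; filterᵇ; length; allFin; upTo; foldl; foldr)
open import Relation.Nullary.Decidable using (⌊_⌋)
open import Relation.Binary.PropositionalEquality using (_≡_)
open import Data.Product using (_×_)
open import Data.Empty using (⊥)

record Graph : Set where
  field
    n          : ℕ
    adj        : Fin n → Fin n → Bool
    adj-sym    : ∀ x y → adj x y ≡ adj y x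
    adj-irrefl : ∀ x → adj x x ≡ false
open Graph public

-- We work with induced subgraphs G[U] given by a vertex subset U.
-- All subsets of Fin n.
-- Boolean 'for all elements of a list'
allᵇ : {A : Set} → (A → Bool) → List A → Bool
allᵇ p []       = true
allᵇ p (x ∷ xs) = p x ∧ allᵇ p xs

allSubsets : ∀ n → List (Subset n)
allSubsets zero    = [] ∷ []
allSubsets (suc n) = map (true ∷_) (allSubsets n) ++ map (false ∷_) (allSubsets n)

module _ (G : Graph) where

  subsetᵇ : Subset (n G) → Subset (n G) → Bool
  subsetᵇ C U = allᵇ (λ x → not (lookup C x) ∨ lookup U x) (allFin (n G))

  isCliqueᵇ : Subset (n G) → Subset (n G) → Bool
  isCliqueᵇ U C = subsetᵇ C U ∧
    allᵇ (λ x → allᵇ (λ y → not (lookup C x ∧ lookup C y ∧ not ⌊ x Fin.≟ y ⌋) ∨ adj G x y)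
                   (allFin (n G)))
        (allFin (n G))

  -- all vertex sets of complete subgraphs of G[U] (including the empty one)
  cliques : Subset (n G) → List (Subset (n G))
  cliques U = filterᵇ (isCliqueᵇ U) (allSubsets (n G))

  -- f_k(G[U]) = number of complete subgraphs with k+1 vertices
  f : Subset (n G) → ℕ → ℕ
  f U k = length (filterᵇ (λ C → ∣ C ∣ ≡ᵇ suc k) (cliques U))

  sgn : ℕ → ℤ
  sgn zero    = + 1
  sgn (suc k) = - sgn k

  pow : ℤ → ℕ → ℤ
  pow t zero    = + 1
  pow t (suc k) = t * pow t k

  -- Euler characteristic χ = Σ_k (-1)^k f_k  (f_k = 0 for k ≥ n)
  χ : Subset (n G) → ℤ
  χ U = foldr (λ k acc → sgn k * + f U k + acc) (+ 0) (upTo (n G))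

  fpoly : Subset (n G) → ℤ → ℤ
  fpoly U t = + 1 + foldr (λ k acc → + f U k * pow t (suc k) + acc) (+ 0) (upTo (n G))

  -- dimension + 1 : (largest k with f_k ≠ 0) + 1, and 0 if there is none
  dim+1 : Subset (n G) → ℕ
  dim+1 U = foldl (λ acc k → if f U k ≡ᵇ 0 then acc else suc k) 0 (upTo (n G))

  -- dimension d (= -1 when there is no nonempty complete subgraph)
  dimension : Subset (n G) → ℤ
  dimension U = + dim+1 U ℤ.- + 1

-- Integer polynomials as coefficient lists (constant term first).

Poly : Set
Poly = List ℤ

infixl 6 _+ₚ_
infixl 7 _*ₚ_ _•ₚ_
infixr 8 _^ₚ_

_+ₚ_ : Poly → Poly → Poly
[]       +ₚ q        = q
(a ∷ p)  +ₚ []       = a ∷ p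
(a ∷ p)  +ₚ (b ∷ q)  = (a + b) ∷ (p +ₚ q)

_•ₚ_ : ℤ → Poly → Poly
c •ₚ p = map (c *_) p

_*ₚ_ : Poly → Poly → Poly
[]      *ₚ q = []
(a ∷ p) *ₚ q = (a •ₚ q) +ₚ (+ 0 ∷ (p *ₚ q))

_^ₚ_ : Poly → ℕ → Poly
p ^ₚ zero    = + 1 ∷ []
p ^ₚ (suc k) = p *ₚ (p ^ₚ k)

x-1 : Poly
x-1 = -[1+ 0 ] ∷ + 1 ∷ []

coeff : Poly → ℕ → ℤ
coeff []      i       = + 0
coeff (a ∷ p) zero    = a
coeff (a ∷ p) (suc i) = coeff p i

module _ (G : Graph) where

  -- h_G(x) = (x-1)^(d+1) f_G(1/(x-1))
  --        = (x-1)^(d+1) + Σ_{k=0}^{d} f_k (x-1)^(d-k)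
  hPoly : Subset (n G) → Poly
  hPoly U = (x-1 ^ₚ D) +ₚ
            foldr (λ k acc → ((+ f G U k) •ₚ (x-1 ^ₚ (D ℕ.∸ suc k))) +ₚ acc) [] (upTo D)
    where D = dim+1 G U

  h : Subset (n G) → ℕ → ℤ
  h U i = coeff (hPoly U) i

  DehnSommerville : Subset (n G) → Set
  DehnSommerville U = ∀ i → i ℕ.≤ dim+1 G U → h U i ≡ h U (dim+1 G U ℕ.∸ i)

  sphere : Subset (n G) → Fin (n G) → Subset (n G)
  sphere U x = U ∩ tabulate (adj G x)

  -- 𝒳' k U  means  G[U] ∈ 𝒳_{k-1}
  𝒳' : ℕ → Subset (n G) → Set
  𝒳' zero    U = ∀ x → lookup U x ≡ false
  𝒳' (suc k) U = (χ G U ≡ + 1 + sgn G k)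
               × (∀ x → lookup U x ≡ true → 𝒳' k (sphere U x))

  -- 𝒳 d U  means  G[U] ∈ 𝒳_d   (classes only defined for d ≥ -1)
  𝒳 : ℤ → Subset (n G) → Set
  𝒳 (+ k)          U = 𝒳' (suc k) U
  𝒳 -[1+ zero ]    U = 𝒳' zero U
  𝒳 -[1+ suc _ ]   U = ⊥

sgnℤ : ℤ → ℤ
sgnℤ (+ k)      = sgn-aux k
  where
  sgn-aux : ℕ → ℤ
  sgn-aux zero    = + 1
  sgn-aux (suc k) = - sgn-aux k
sgnℤ -[1+ k ]   = sgnℤ (+ suc k)

V : (G : Graph) → Subset (n G)
V G = Data.Fin.Subset.⊤

module Submission where

open import Defs
open import Data.Integer using (ℤ; +_; -[1+_]; _+_; _*_; _-_; _≤_)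
open import Data.Product using (_×_)
open import Relation.Binary.PropositionalEquality using (_≡_)

-- Write f_U(t) = 1 + Σ_k f_k(G[U]) t^(k+1) for the f-polynomial of the induced subgraph G[U].
-- (1) Gauss–Bonnet: counting the pairs (x, C) of a vertex and a clique through it in two ways
--     gives f_U' = Σ_(x ∈ U) f_(S(x)).
-- (2) Functional equation: if G[U] ∈ 𝒳_d then f_U(t) + (-1)^d f_U(-1-t) = 0.  By induction on d:
--     by (1) and the induction hypothesis for the unit spheres the left side has derivative 0,
--     so it is constant, and its value at t = -1 is 1 - χ + (-1)^d = 0.
-- (3) Reciprocity: with D = d + 1 the h-polynomial is h(x) = Σ_j F_j (x-1)^(D-j), a
--     homogenisation of the f-polynomial F, and the functional equation turns into
--     h(x) = x^D h(1/x), i.e. h_i = h_(D-i).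
-- Everything happens over ℤ: polynomials are coefficient lists, identities between them are
-- proved by evaluating at all integers (identity theorem), and x^D h(1/x) is handled through
-- the two-variable homogenisation Σ_j p_j u^j w^(D-j) instead of rational functions.

open import Data.Nat as ℕ using (ℕ; zero; suc; z≤n; s≤s; _∸_; _≡ᵇ_)
import Data.Nat.Properties as ℕP
import Algebra.Properties.CommutativeSemigroup ℕP.+-commutativeSemigroup as ℕ+
open import Data.Integer as ℤ using (-_; _^_)
import Data.Integer.Properties as ℤP
open import Data.Integer.Tactic.RingSolver using (solve-∀)
open import Data.Bool using (Bool; true; false; _∧_; _∨_; not; if_then_else_; T)
import Data.Bool.Properties as BoolP
open import Data.Fin as Fin using (Fin)
open import Data.Fin.Subset using (Subset; ∣_∣)
import Data.Fin.Subset.Properties as SubsetP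
open import Data.Vec using ([]; _∷_; lookup; tabulate; replicate; _[_]≔_)
import Data.Vec.Properties as VecP
open import Data.List using (List; []; _∷_; _++_; map; foldr; foldl; filterᵇ; length; applyUpTo; upTo; allFin)
import Data.List.Properties as ListP
open import Data.List.Membership.Propositional using (_∈_)
open import Data.List.Membership.Propositional.Properties using (∈-allFin)
open import Data.List.Relation.Unary.Any using (here; there)
open import Data.Sum using (_⊎_; inj₁; inj₂)
open import Data.Empty using (⊥-elim)
open import Data.Unit using (tt)
open import Data.Product using (Σ; _,_; proj₁)
open import Function using (case_of_)
open import Relation.Nullary using (¬_; yes; no; Dec)
open import Relation.Nullary.Decidable using (⌊_⌋)
open import Relation.Binary.PropositionalEquality
  using (refl; sym; trans; cong; cong₂; subst; _≢_; module ≡-Reasoning)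

∑< : ℕ → (ℕ → ℤ) → ℤ
∑< zero    g = + 0
∑< (suc m) g = g 0 + ∑< m (λ k → g (suc k))

∑<-foldr : ∀ m (fn : ℕ → ℕ) (g : ℕ → ℤ) →
  foldr (λ k acc → g k + acc) (+ 0) (applyUpTo fn m) ≡ ∑< m (λ j → g (fn j))
∑<-foldr zero    fn g = refl
∑<-foldr (suc m) fn g = cong (_+_ (g (fn 0))) (∑<-foldr m (λ j → fn (suc j)) g)

∑<-cong : ∀ m {g h : ℕ → ℤ} → (∀ k → k ℕ.< m → g k ≡ h k) → ∑< m g ≡ ∑< m h
∑<-cong zero    eq = refl
∑<-cong (suc m) eq = cong₂ _+_ (eq 0 (s≤s z≤n)) (∑<-cong m (λ k k<m → eq (suc k) (s≤s k<m)))

∑<-scale : ∀ m c (g : ℕ → ℤ) → ∑< m (λ k → c * g k) ≡ c * ∑< m g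
∑<-scale zero    c g = sym (ℤP.*-zeroʳ c)
∑<-scale (suc m) c g =
  trans (cong (_+_ (c * g 0)) (∑<-scale m c _)) (sym (ℤP.*-distribˡ-+ c (g 0) _))

∑<-snoc : ∀ m (g : ℕ → ℤ) → ∑< (suc m) g ≡ ∑< m g + g m
∑<-snoc zero    g = ℤP.+-comm (g 0) (+ 0)
∑<-snoc (suc m) g = trans (cong (_+_ (g 0)) (∑<-snoc m _)) (sym (ℤP.+-assoc (g 0) _ _))

^-distrib-* : ∀ a b k → (a * b) ^ k ≡ a ^ k * b ^ k
^-distrib-* a b zero    = refl
^-distrib-* a b (suc k) = trans (cong ((a * b) *_) (^-distrib-* a b k)) (interchange a b _ _)
  where
  interchange : ∀ a b c d → (a * b) * (c * d) ≡ (a * c) * (b * d)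
  interchange = solve-∀

infix 4 _≈ₚ_
_≈ₚ_ : Poly → Poly → Set
p ≈ₚ q = ∀ i → coeff p i ≡ coeff q i

coeff-+ : ∀ p q i → coeff (p +ₚ q) i ≡ coeff p i + coeff q i
coeff-+ []      q       i       = sym (ℤP.+-identityˡ _)
coeff-+ (a ∷ p) []      i       = sym (ℤP.+-identityʳ _)
coeff-+ (a ∷ p) (b ∷ q) zero    = refl
coeff-+ (a ∷ p) (b ∷ q) (suc i) = coeff-+ p q i

coeff-• : ∀ c p i → coeff (c •ₚ p) i ≡ c * coeff p i
coeff-• c []      i       = sym (ℤP.*-zeroʳ c)
coeff-• c (a ∷ p) zero    = refl
coeff-• c (a ∷ p) (suc i) = coeff-• c p i

ev : Poly → ℤ → ℤ
ev []      t = + 0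
ev (a ∷ p) t = a + t * ev p t

ev-at-0 : ∀ p → ev p (+ 0) ≡ coeff p 0
ev-at-0 []      = refl
ev-at-0 (a ∷ p) = ℤP.+-identityʳ a

ev-+ : ∀ p q t → ev (p +ₚ q) t ≡ ev p t + ev q t
ev-+ []      q       t = sym (ℤP.+-identityˡ _)
ev-+ (a ∷ p) []      t = sym (ℤP.+-identityʳ _)
ev-+ (a ∷ p) (b ∷ q) t =
  trans (cong (λ u → (a + b) + t * u) (ev-+ p q t)) (rearrange a b t (ev p t) (ev q t))
  where
  rearrange : ∀ a b t x y → (a + b) + t * (x + y) ≡ (a + t * x) + (b + t * y)
  rearrange = solve-∀

ev-• : ∀ c p t → ev (c •ₚ p) t ≡ c * ev p t
ev-• c []      t = sym (ℤP.*-zeroʳ c)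
ev-• c (a ∷ p) t = trans (cong (λ u → c * a + t * u) (ev-• c p t)) (rearrange c a t (ev p t))
  where
  rearrange : ∀ c a t x → c * a + t * (c * x) ≡ c * (a + t * x)
  rearrange = solve-∀

ev-* : ∀ p q t → ev (p *ₚ q) t ≡ ev p t * ev q t
ev-* []      q t = sym (ℤP.*-zeroˡ (ev q t))
ev-* (a ∷ p) q t = begin
  ev ((a •ₚ q) +ₚ (+ 0 ∷ (p *ₚ q))) t   ≡⟨ ev-+ (a •ₚ q) (+ 0 ∷ (p *ₚ q)) t ⟩
  ev (a •ₚ q) t + (+ 0 + t * ev (p *ₚ q) t)
    ≡⟨ cong₂ (λ u v → u + (+ 0 + t * v)) (ev-• a q t) (ev-* p q t) ⟩
  a * ev q t + (+ 0 + t * (ev p t * ev q t)) ≡⟨ rearrange a t (ev p t) (ev q t) ⟩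
  (a + t * ev p t) * ev q t                  ∎
  where
  open ≡-Reasoning
  rearrange : ∀ a t x y → a * y + (+ 0 + t * (x * y)) ≡ (a + t * x) * y
  rearrange = solve-∀

ev-≈ : ∀ p q → p ≈ₚ q → ∀ t → ev p t ≡ ev q t
ev-≈ []      []      eq t = refl
ev-≈ []      (b ∷ q) eq t =
  sym (trans (cong₂ (λ u v → u + t * v) (sym (eq 0)) (sym (ev-≈ [] q (λ i → eq (suc i)) t)))
             (cong (_+_ (+ 0)) (ℤP.*-zeroʳ t)))
ev-≈ (a ∷ p) []      eq t =
  trans (cong₂ (λ u v → u + t * v) (eq 0) (ev-≈ p [] (λ i → eq (suc i)) t))
        (cong (_+_ (+ 0)) (ℤP.*-zeroʳ t))
ev-≈ (a ∷ p) (b ∷ q) eq t = cong₂ (λ u v → u + t * v) (eq 0) (ev-≈ p q (λ i → eq (suc i)) t)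

difference-zero : ∀ x y → x + -[1+ 0 ] * y ≡ + 0 → x ≡ y
difference-zero x y eq = begin
  x                          ≡⟨ split x y ⟩
  (x + -[1+ 0 ] * y) + y     ≡⟨ cong (_+ y) eq ⟩
  + 0 + y                    ≡⟨ ℤP.+-identityˡ y ⟩
  y                          ∎
  where
  open ≡-Reasoning
  split : ∀ x y → x ≡ (x + -[1+ 0 ] * y) + y
  split = solve-∀

sum-zero⇒≡-neg : ∀ a b → a + b ≡ + 0 → a ≡ - b
sum-zero⇒≡-neg a b eq = begin
  a                ≡⟨ split a b ⟩
  (a + b) + - b    ≡⟨ cong (_+ - b) eq ⟩
  + 0 + - b        ≡⟨ ℤP.+-identityˡ (- b) ⟩
  - b              ∎
  where
  open ≡-Reasoning
  split : ∀ a b → a ≡ (a + b) + - b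
  split = solve-∀

-- With t₀ = |a| + M + 1 the constant term satisfies |a| = t₀·|p(t₀)|, which forces
-- a = 0; then t·p(t) = 0, so p(t) = 0, for all |t| ≥ M + 1.
vanishing⇒zero : ∀ p M → (∀ t → M ℕ.≤ ℤ.∣ t ∣ → ev p t ≡ + 0) → p ≈ₚ []
vanishing⇒zero []      M vanish i = refl
vanishing⇒zero (a ∷ p) M vanish = λ { zero → a≡0 ; (suc i) → vanishing⇒zero p (suc M) p-vanishes i }
  where
  t₀ : ℤ
  t₀ = + suc (ℤ.∣ a ∣ ℕ.+ M)
  e : ℤ
  e = ev p t₀
  a≡-t₀e : a ≡ - (t₀ * e)
  a≡-t₀e = sum-zero⇒≡-neg a (t₀ * e) (vanish t₀ (ℕP.≤-trans (ℕP.m≤n+m M ℤ.∣ a ∣) (ℕP.n≤1+n _)))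
  ∣a∣≡t₀∣e∣ : ℤ.∣ a ∣ ≡ suc (ℤ.∣ a ∣ ℕ.+ M) ℕ.* ℤ.∣ e ∣
  ∣a∣≡t₀∣e∣ = trans (cong ℤ.∣_∣ a≡-t₀e) (trans (ℤP.∣-i∣≡∣i∣ (t₀ * e)) (ℤP.abs-* t₀ e))
  a≡0 : a ≡ + 0
  a≡0 with ℤ.∣ e ∣ | ∣a∣≡t₀∣e∣
  ... | zero  | eq = ℤP.∣i∣≡0⇒i≡0 (trans eq (ℕP.*-zeroʳ (suc (ℤ.∣ a ∣ ℕ.+ M))))
  ... | suc k | eq = ⊥-elim (ℕP.<-irrefl eq (ℕP.≤-trans (s≤s (ℕP.m≤m+n ℤ.∣ a ∣ M))
                                                         (ℕP.m≤m*n (suc (ℤ.∣ a ∣ ℕ.+ M)) (suc k))))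
  p-vanishes : ∀ t → suc M ℕ.≤ ℤ.∣ t ∣ → ev p t ≡ + 0
  p-vanishes t M<∣t∣ with ℤP.i*j≡0⇒i≡0∨j≡0 t t*pt≡0
    where
    t*pt≡0 : t * ev p t ≡ + 0
    t*pt≡0 = begin
      t * ev p t            ≡⟨ sym (ℤP.+-identityˡ _) ⟩
      + 0 + t * ev p t      ≡⟨ cong (λ u → u + t * ev p t) (sym a≡0) ⟩
      a + t * ev p t        ≡⟨ vanish t (ℕP.≤-trans (ℕP.n≤1+n M) M<∣t∣) ⟩
      + 0                   ∎
      where open ≡-Reasoning
  ... | inj₂ pt≡0 = pt≡0
  ... | inj₁ refl with M<∣t∣
  ...   | ()

≈-by-ev : ∀ p q → (∀ t → ev p t ≡ ev q t) → p ≈ₚ q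
≈-by-ev p q same i = difference-zero (coeff p i) (coeff q i) (begin
  coeff p i + -[1+ 0 ] * coeff q i   ≡⟨ cong (_+_ (coeff p i)) (sym (coeff-• -[1+ 0 ] q i)) ⟩
  coeff p i + coeff -q i             ≡⟨ sym (coeff-+ p -q i) ⟩
  coeff (p +ₚ -q) i                  ≡⟨ vanishing⇒zero (p +ₚ -q) 0 (λ t _ → p-q-vanishes t) i ⟩
  + 0                                ∎)
  where
  open ≡-Reasoning
  -q : Poly
  -q = -[1+ 0 ] •ₚ q
  p-q-vanishes : ∀ t → ev (p +ₚ -q) t ≡ + 0
  p-q-vanishes t = begin
    ev (p +ₚ -q) t                     ≡⟨ ev-+ p -q t ⟩
    ev p t + ev -q t                   ≡⟨ cong₂ _+_ (same t) (ev-• -[1+ 0 ] q t) ⟩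
    ev q t + -[1+ 0 ] * ev q t         ≡⟨ cancel (ev q t) ⟩
    + 0                                ∎
    where
    cancel : ∀ x → x + -[1+ 0 ] * x ≡ + 0
    cancel = solve-∀

coeff-map-applyUpTo : ∀ (c : ℕ → ℤ) (fn : ℕ → ℕ) m j → (m ℕ.≤ j → c (fn j) ≡ + 0) →
  coeff (map c (applyUpTo fn m)) j ≡ c (fn j)
coeff-map-applyUpTo c fn zero    j       beyond = sym (beyond z≤n)
coeff-map-applyUpTo c fn (suc m) zero    beyond = refl
coeff-map-applyUpTo c fn (suc m) (suc j) beyond =
  coeff-map-applyUpTo c (λ k → fn (suc k)) m j (λ m≤j → beyond (s≤s m≤j))

ev-map-applyUpTo : ∀ (c : ℕ → ℤ) (fn : ℕ → ℕ) m t →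
  ev (map c (applyUpTo fn m)) t ≡ ∑< m (λ j → c (fn j) * t ^ j)
ev-map-applyUpTo c fn zero    t = refl
ev-map-applyUpTo c fn (suc m) t = begin
  c (fn 0) + t * ev (map c (applyUpTo (λ k → fn (suc k)) m)) t
    ≡⟨ cong (λ v → c (fn 0) + t * v) (ev-map-applyUpTo c (λ k → fn (suc k)) m t) ⟩
  c (fn 0) + t * ∑< m (λ j → c (fn (suc j)) * t ^ j)
    ≡⟨ cong₂ _+_ (sym (ℤP.*-identityʳ (c (fn 0)))) (sym (∑<-scale m t _)) ⟩
  c (fn 0) * + 1 + ∑< m (λ j → t * (c (fn (suc j)) * t ^ j))
    ≡⟨ cong (_+_ (c (fn 0) * + 1)) (∑<-cong m (λ j _ → move-t t (c (fn (suc j))) (t ^ j))) ⟩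
  c (fn 0) * + 1 + ∑< m (λ j → c (fn (suc j)) * (t * t ^ j)) ∎
  where
  open ≡-Reasoning
  move-t : ∀ t a x → t * (a * x) ≡ a * (t * x)
  move-t = solve-∀

Deg≤ : Poly → ℕ → Set
Deg≤ p D = ∀ i → D ℕ.< i → coeff p i ≡ + 0

ev-deg0 : ∀ p → Deg≤ p 0 → ∀ t → ev p t ≡ coeff p 0
ev-deg0 p deg0 t =
  trans (ev-≈ p (coeff p 0 ∷ []) p≈const t)
        (trans (cong (_+_ (coeff p 0)) (ℤP.*-zeroʳ t)) (ℤP.+-identityʳ _))
  where
  p≈const : p ≈ₚ (coeff p 0 ∷ [])
  p≈const zero    = refl
  p≈const (suc i) = deg0 (suc i) (s≤s z≤n)

der : Poly → Poly
der []      = []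
der (a ∷ p) = p +ₚ (+ 0 ∷ der p)

coeff-der : ∀ p i → coeff (der p) i ≡ + suc i * coeff p (suc i)
coeff-der []      i       = sym (ℤP.*-zeroʳ (+ suc i))
coeff-der (a ∷ p) zero    =
  trans (coeff-+ p (+ 0 ∷ der p) 0) (trans (ℤP.+-identityʳ _) (sym (ℤP.*-identityˡ _)))
coeff-der (a ∷ p) (suc i) =
  trans (coeff-+ p (+ 0 ∷ der p) (suc i))
        (trans (cong (_+_ (coeff p (suc i))) (coeff-der p i)) (collect (+ suc i) (coeff p (suc i))))
  where
  collect : ∀ k c → c + k * c ≡ (+ 1 + k) * c
  collect = solve-∀

ev-der-∷ : ∀ a p t → ev (der (a ∷ p)) t ≡ ev p t + t * ev (der p) t
ev-der-∷ a p t = trans (ev-+ p (+ 0 ∷ der p) t) (cong (_+_ (ev p t)) (ℤP.+-identityˡ _))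

ev-der-+ : ∀ p q t → ev (der (p +ₚ q)) t ≡ ev (der p) t + ev (der q) t
ev-der-+ []      q       t = sym (ℤP.+-identityˡ _)
ev-der-+ (a ∷ p) []      t = sym (ℤP.+-identityʳ _)
ev-der-+ (a ∷ p) (b ∷ q) t = begin
  ev (der ((a + b) ∷ (p +ₚ q))) t                   ≡⟨ ev-der-∷ (a + b) (p +ₚ q) t ⟩
  ev (p +ₚ q) t + t * ev (der (p +ₚ q)) t
    ≡⟨ cong₂ (λ u v → u + t * v) (ev-+ p q t) (ev-der-+ p q t) ⟩
  (ev p t + ev q t) + t * (ev (der p) t + ev (der q) t)
    ≡⟨ rearrange (ev p t) (ev q t) t (ev (der p) t) (ev (der q) t) ⟩
  (ev p t + t * ev (der p) t) + (ev q t + t * ev (der q) t)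
    ≡⟨ sym (cong₂ _+_ (ev-der-∷ a p t) (ev-der-∷ b q t)) ⟩
  ev (der (a ∷ p)) t + ev (der (b ∷ q)) t           ∎
  where
  open ≡-Reasoning
  rearrange : ∀ x y t dx dy → (x + y) + t * (dx + dy) ≡ (x + t * dx) + (y + t * dy)
  rearrange = solve-∀

ev-der-• : ∀ c p t → ev (der (c •ₚ p)) t ≡ c * ev (der p) t
ev-der-• c []      t = sym (ℤP.*-zeroʳ c)
ev-der-• c (a ∷ p) t = begin
  ev (der (c * a ∷ c •ₚ p)) t                 ≡⟨ ev-der-∷ (c * a) (c •ₚ p) t ⟩
  ev (c •ₚ p) t + t * ev (der (c •ₚ p)) t     ≡⟨ cong₂ (λ u v → u + t * v) (ev-• c p t) (ev-der-• c p t) ⟩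
  c * ev p t + t * (c * ev (der p) t)         ≡⟨ rearrange c t (ev p t) (ev (der p) t) ⟩
  c * (ev p t + t * ev (der p) t)             ≡⟨ cong (c *_) (sym (ev-der-∷ a p t)) ⟩
  c * ev (der (a ∷ p)) t                      ∎
  where
  open ≡-Reasoning
  rearrange : ∀ c t x dx → c * x + t * (c * dx) ≡ c * (x + t * dx)
  rearrange = solve-∀

ev-der-* : ∀ p q t → ev (der (p *ₚ q)) t ≡ ev (der p) t * ev q t + ev p t * ev (der q) t
ev-der-* []      q t = sym (vanish (ev q t) (ev (der q) t))
  where
  vanish : ∀ y dy → + 0 * y + + 0 * dy ≡ + 0
  vanish = solve-∀
ev-der-* (a ∷ p) q t = begin
  ev (der ((a •ₚ q) +ₚ (+ 0 ∷ (p *ₚ q)))) t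
    ≡⟨ ev-der-+ (a •ₚ q) (+ 0 ∷ (p *ₚ q)) t ⟩
  ev (der (a •ₚ q)) t + ev (der (+ 0 ∷ (p *ₚ q))) t
    ≡⟨ cong₂ _+_ (ev-der-• a q t) (ev-der-∷ (+ 0) (p *ₚ q) t) ⟩
  a * ev (der q) t + (ev (p *ₚ q) t + t * ev (der (p *ₚ q)) t)
    ≡⟨ cong₂ (λ u v → a * ev (der q) t + (u + t * v)) (ev-* p q t) (ev-der-* p q t) ⟩
  a * ev (der q) t + (ev p t * ev q t + t * (ev (der p) t * ev q t + ev p t * ev (der q) t))
    ≡⟨ rearrange a t (ev p t) (ev q t) (ev (der p) t) (ev (der q) t) ⟩
  (ev p t + t * ev (der p) t) * ev q t + (a + t * ev p t) * ev (der q) t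
    ≡⟨ cong (λ u → u * ev q t + (a + t * ev p t) * ev (der q) t) (sym (ev-der-∷ a p t)) ⟩
  ev (der (a ∷ p)) t * ev q t + ev (a ∷ p) t * ev (der q) t ∎
  where
  open ≡-Reasoning
  rearrange : ∀ a t x y dx dy →
    a * dy + (x * y + t * (dx * y + x * dy)) ≡ (x + t * dx) * y + (a + t * x) * dy
  rearrange = solve-∀

comp : Poly → Poly → Poly
comp []      q = []
comp (a ∷ p) q = (a ∷ []) +ₚ (q *ₚ comp p q)

ev-comp : ∀ p q t → ev (comp p q) t ≡ ev p (ev q t)
ev-comp []      q t = refl
ev-comp (a ∷ p) q t = begin
  ev ((a ∷ []) +ₚ (q *ₚ comp p q)) t        ≡⟨ ev-+ (a ∷ []) (q *ₚ comp p q) t ⟩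
  (a + t * + 0) + ev (q *ₚ comp p q) t      ≡⟨ cong₂ _+_ (ev-constant a t) (ev-* q (comp p q) t) ⟩
  a + ev q t * ev (comp p q) t              ≡⟨ cong (λ u → a + ev q t * u) (ev-comp p q t) ⟩
  a + ev q t * ev p (ev q t)                ∎
  where
  open ≡-Reasoning
  ev-constant : ∀ a t → a + t * + 0 ≡ a
  ev-constant = solve-∀

ev-der-comp : ∀ p q t → ev (der (comp p q)) t ≡ ev (der p) (ev q t) * ev (der q) t
ev-der-comp []      q t = sym (ℤP.*-zeroˡ (ev (der q) t))
ev-der-comp (a ∷ p) q t = begin
  ev (der ((a ∷ []) +ₚ (q *ₚ comp p q))) t
    ≡⟨ ev-der-+ (a ∷ []) (q *ₚ comp p q) t ⟩
  ev (der (a ∷ [])) t + ev (der (q *ₚ comp p q)) t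
    ≡⟨ cong (_+_ (ev (der (a ∷ [])) t)) (ev-der-* q (comp p q) t) ⟩
  (+ 0 + t * + 0) + (dq * ev (comp p q) t + ev q t * ev (der (comp p q)) t)
    ≡⟨ cong₂ (λ u v → (+ 0 + t * + 0) + (dq * u + ev q t * v)) (ev-comp p q t) (ev-der-comp p q t) ⟩
  (+ 0 + t * + 0) + (dq * ev p (ev q t) + ev q t * (ev (der p) (ev q t) * dq))
    ≡⟨ rearrange t dq (ev p (ev q t)) (ev q t) (ev (der p) (ev q t)) ⟩
  (ev p (ev q t) + ev q t * ev (der p) (ev q t)) * dq
    ≡⟨ cong (_* dq) (sym (ev-der-∷ a p (ev q t))) ⟩
  ev (der (a ∷ p)) (ev q t) * dq ∎
  where
  open ≡-Reasoning
  dq : ℤ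
  dq = ev (der q) t
  rearrange : ∀ t dq x y dx → (+ 0 + t * + 0) + (dq * x + y * (dx * dq)) ≡ (x + y * dx) * dq
  rearrange = solve-∀

-- A polynomial whose derivative vanishes identically is constant: the coefficient
-- (i+1)·p_(i+1) of p' vanishes by the identity theorem.
der-vanishes⇒constant : ∀ p → (∀ t → ev (der p) t ≡ + 0) → ∀ t → ev p t ≡ coeff p 0
der-vanishes⇒constant p der-vanishes = ev-deg0 p deg0
  where
  deg0 : Deg≤ p 0
  deg0 (suc i) _ with ℤP.i*j≡0⇒i≡0∨j≡0 (+ suc i)
                        (trans (sym (coeff-der p i)) (vanishing⇒zero (der p) 0 (λ t _ → der-vanishes t) i))
  ... | inj₂ c≡0 = c≡0

reflection : Poly
reflection = -[1+ 0 ] ∷ -[1+ 0 ] ∷ []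

ev-reflection : ∀ t → ev reflection t ≡ -[1+ 0 ] - t
ev-reflection t = normalise t
  where
  normalise : ∀ t → -[1+ 0 ] + t * (-[1+ 0 ] + t * + 0) ≡ -[1+ 0 ] - t
  normalise = solve-∀

FunEq : ℤ → Poly → Set
FunEq s p = ∀ t → ev p t + s * ev p (-[1+ 0 ] - t) ≡ + 0

FunEq-≈ : ∀ s p q → p ≈ₚ q → FunEq s p → FunEq s q
FunEq-≈ s p q p≈q fe t =
  trans (cong₂ (λ u v → u + s * v) (sym (ev-≈ p q p≈q t)) (sym (ev-≈ p q p≈q (-[1+ 0 ] - t)))) (fe t)

FunEq-[] : ∀ s → FunEq s []
FunEq-[] s t = trans (ℤP.+-identityˡ _) (ℤP.*-zeroʳ s)

FunEq-+ : ∀ s p q → FunEq s p → FunEq s q → FunEq s (p +ₚ q)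
FunEq-+ s p q fe-p fe-q t = begin
  ev (p +ₚ q) t + s * ev (p +ₚ q) r
    ≡⟨ cong₂ (λ u v → u + s * v) (ev-+ p q t) (ev-+ p q r) ⟩
  (ev p t + ev q t) + s * (ev p r + ev q r)
    ≡⟨ rearrange s (ev p t) (ev q t) (ev p r) (ev q r) ⟩
  (ev p t + s * ev p r) + (ev q t + s * ev q r)
    ≡⟨ cong₂ _+_ (fe-p t) (fe-q t) ⟩
  + 0 ∎
  where
  open ≡-Reasoning
  r : ℤ
  r = -[1+ 0 ] - t
  rearrange : ∀ s a b c d → (a + b) + s * (c + d) ≡ (a + s * c) + (b + s * d)
  rearrange = solve-∀

symmetrised : ℤ → Poly → Poly
symmetrised s p = p +ₚ (s •ₚ comp p reflection)

ev-symmetrised : ∀ s p t → ev (symmetrised s p) t ≡ ev p t + s * ev p (-[1+ 0 ] - t)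
ev-symmetrised s p t = begin
  ev (symmetrised s p) t                   ≡⟨ ev-+ p (s •ₚ comp p reflection) t ⟩
  ev p t + ev (s •ₚ comp p reflection) t   ≡⟨ cong (_+_ (ev p t)) (ev-• s (comp p reflection) t) ⟩
  ev p t + s * ev (comp p reflection) t    ≡⟨ cong (λ u → ev p t + s * u) (ev-comp p reflection t) ⟩
  ev p t + s * ev p (ev reflection t)      ≡⟨ cong (λ u → ev p t + s * ev p u) (ev-reflection t) ⟩
  ev p t + s * ev p (-[1+ 0 ] - t)         ∎
  where open ≡-Reasoning

FunEq⇒symmetrised-zero : ∀ s p → FunEq s p → symmetrised s p ≈ₚ []
FunEq⇒symmetrised-zero s p fe = ≈-by-ev (symmetrised s p) [] (λ t → trans (ev-symmetrised s p t) (fe t))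

-- Indeed the derivative
-- of p(t) + s·p(-1-t) is p'(t) - s·p'(-1-t) = 0, so this polynomial is constant, and its
-- value at t = -1 is p(-1) + s·p(0).
FunEq-integrate : ∀ s p → FunEq (- s) (der p) → ev p -[1+ 0 ] + s * ev p (+ 0) ≡ + 0 → FunEq s p
FunEq-integrate s p fe-der at-minus-one t = begin
  ev p t + s * ev p (-[1+ 0 ] - t)   ≡⟨ sym (ev-symmetrised s p t) ⟩
  ev g t                             ≡⟨ der-vanishes⇒constant g der-g-vanishes t ⟩
  coeff g 0                          ≡⟨ sym (der-vanishes⇒constant g der-g-vanishes -[1+ 0 ]) ⟩
  ev g -[1+ 0 ]                      ≡⟨ ev-symmetrised s p -[1+ 0 ] ⟩
  ev p -[1+ 0 ] + s * ev p (+ 0)     ≡⟨ at-minus-one ⟩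
  + 0                                ∎
  where
  open ≡-Reasoning
  g : Poly
  g = symmetrised s p
  der-g-vanishes : ∀ u → ev (der g) u ≡ + 0
  der-g-vanishes u = begin
    ev (der g) u
      ≡⟨ ev-der-+ p (s •ₚ comp p reflection) u ⟩
    ev (der p) u + ev (der (s •ₚ comp p reflection)) u
      ≡⟨ cong (_+_ (ev (der p) u)) (ev-der-• s (comp p reflection) u) ⟩
    ev (der p) u + s * ev (der (comp p reflection)) u
      ≡⟨ cong (λ v → ev (der p) u + s * v) (ev-der-comp p reflection u) ⟩
    ev (der p) u + s * (ev (der p) (ev reflection u) * ev (der reflection) u)
      ≡⟨ cong (λ v → ev (der p) u + s * (ev (der p) v * ev (der reflection) u)) (ev-reflection u) ⟩
    ev (der p) u + s * (ev (der p) (-[1+ 0 ] - u) * ev (der reflection) u)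
      ≡⟨ flip-sign s (ev (der p) u) (ev (der p) (-[1+ 0 ] - u)) u ⟩
    ev (der p) u + - s * ev (der p) (-[1+ 0 ] - u)
      ≡⟨ fe-der u ⟩
    + 0 ∎
    where
    flip-sign : ∀ s a b u → a + s * (b * (-[1+ 0 ] + u * (+ 0 + u * + 0))) ≡ a + - s * b
    flip-sign = solve-∀

∑ₚ : {X : Set} → (X → Poly) → List X → Poly
∑ₚ P xs = foldr (λ x acc → P x +ₚ acc) [] xs

FunEq-∑ₚ : ∀ {X : Set} s (P : X → Poly) xs → (∀ x → FunEq s (P x)) → FunEq s (∑ₚ P xs)
FunEq-∑ₚ s P []       fe = FunEq-[] s
FunEq-∑ₚ s P (x ∷ xs) fe = FunEq-+ s (P x) (∑ₚ P xs) (fe x) (FunEq-∑ₚ s P xs fe)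

zero-*ˡ : ∀ p q → p ≈ₚ [] → p *ₚ q ≈ₚ []
zero-*ˡ p q p≈0 = ≈-by-ev (p *ₚ q) [] λ t →
  trans (ev-* p q t) (trans (cong (_* ev q t) (ev-≈ p [] p≈0 t)) (ℤP.*-zeroˡ (ev q t)))

zero-*ʳ : ∀ p q → q ≈ₚ [] → p *ₚ q ≈ₚ []
zero-*ʳ p q q≈0 = ≈-by-ev (p *ₚ q) [] λ t →
  trans (ev-* p q t) (trans (cong (ev p t *_) (ev-≈ q [] q≈0 t)) (ℤP.*-zeroʳ (ev p t)))

zero-comp : ∀ p q → p ≈ₚ [] → comp p q ≈ₚ []
zero-comp p q p≈0 = ≈-by-ev (comp p q) [] λ t → trans (ev-comp p q t) (ev-≈ p [] p≈0 (ev q t))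

*-deg0 : ∀ p q → Deg≤ p 0 → p *ₚ q ≈ₚ coeff p 0 •ₚ q
*-deg0 p q deg0 = ≈-by-ev (p *ₚ q) (coeff p 0 •ₚ q) λ t →
  trans (ev-* p q t) (trans (cong (_* ev q t) (ev-deg0 p deg0 t)) (sym (ev-• (coeff p 0) q t)))

tail-deg : ∀ {a p D} → Deg≤ (a ∷ p) (suc D) → Deg≤ p D
tail-deg deg i D<i = deg (suc i) (s≤s D<i)

tail-zero : ∀ {a p} → Deg≤ (a ∷ p) 0 → p ≈ₚ []
tail-zero deg i = deg (suc i) (s≤s z≤n)

deg-mono : ∀ p {m D} → Deg≤ p m → m ℕ.≤ D → Deg≤ p D
deg-mono p deg m≤D i D<i = deg i (ℕP.≤-<-trans m≤D D<i)

deg-const : ∀ a D → Deg≤ (a ∷ []) D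
deg-const a D (suc i) _ = refl

deg-+ : ∀ p q D → Deg≤ p D → Deg≤ q D → Deg≤ (p +ₚ q) D
deg-+ p q D dp dq i D<i = trans (coeff-+ p q i) (cong₂ _+_ (dp i D<i) (dq i D<i))

deg-• : ∀ c p D → Deg≤ p D → Deg≤ (c •ₚ p) D
deg-• c p D dp i D<i = trans (coeff-• c p i) (trans (cong (c *_) (dp i D<i)) (ℤP.*-zeroʳ c))

deg-* : ∀ p q D₁ D₂ → Deg≤ p D₁ → Deg≤ q D₂ → Deg≤ (p *ₚ q) (D₁ ℕ.+ D₂)
deg-* []      q D₁ D₂ dp dq i       _   = refl
deg-* (a ∷ p) q D₁ D₂ dp dq (suc i) D<i =
  trans (coeff-+ (a •ₚ q) (+ 0 ∷ (p *ₚ q)) (suc i))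
        (cong₂ _+_ (deg-• a q D₂ dq (suc i) (ℕP.≤-<-trans (ℕP.m≤n+m D₂ D₁) D<i)) (tail-product D₁ dp D<i))
  where
  tail-product : ∀ D₁ → Deg≤ (a ∷ p) D₁ → D₁ ℕ.+ D₂ ℕ.< suc i → coeff (p *ₚ q) i ≡ + 0
  tail-product zero      dp _         = zero-*ˡ p q (tail-zero dp) i
  tail-product (suc D₁) dp (s≤s D<i) = deg-* p q D₁ D₂ (tail-deg dp) dq i D<i

deg-∑ₚ : ∀ {X : Set} (P : X → Poly) xs D → (∀ x → Deg≤ (P x) D) → Deg≤ (∑ₚ P xs) D
deg-∑ₚ P []       D deg i _ = refl
deg-∑ₚ P (x ∷ xs) D deg     = deg-+ (P x) (∑ₚ P xs) D (deg x) (deg-∑ₚ P xs D deg)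

deg-comp : ∀ p q D → Deg≤ p D → Deg≤ q 1 → Deg≤ (comp p q) D
deg-comp []      q D       dp dq i _ = refl
deg-comp (a ∷ p) q zero    dp dq     =
  deg-+ (a ∷ []) (q *ₚ comp p q) 0 (deg-const a 0)
        (λ i _ → zero-*ʳ q (comp p q) (zero-comp p q (tail-zero dp)) i)
deg-comp (a ∷ p) q (suc D) dp dq     =
  deg-+ (a ∷ []) (q *ₚ comp p q) (suc D) (deg-const a (suc D))
        (deg-* q (comp p q) 1 D dq (deg-comp p q D (tail-deg dp) dq))

deg-^ : ∀ p m → Deg≤ p 1 → Deg≤ (p ^ₚ m) m
deg-^ p zero    dp = deg-const (+ 1) 0
deg-^ p (suc m) dp = deg-* p (p ^ₚ m) 1 m dp (deg-^ p m dp)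

deg-x-1 : Deg≤ x-1 1
deg-x-1 (suc zero)    (s≤s ())
deg-x-1 (suc (suc i)) _ = refl

deg-reflection : Deg≤ reflection 1
deg-reflection (suc zero)    (s≤s ())
deg-reflection (suc (suc i)) _ = refl

-- Degree-D homogenisation of p evaluated at (u, w):  homog D p u w = Σ_{j ≤ D} p_j u^j w^(D-j).
homog : ℕ → Poly → ℤ → ℤ → ℤ
homog zero    p u w = coeff p 0
homog (suc D) p u w = coeff p (suc D) * u ^ suc D + w * homog D p u w

homog-≈ : ∀ D p q u w → p ≈ₚ q → homog D p u w ≡ homog D q u w
homog-≈ zero    p q u w p≈q = p≈q 0
homog-≈ (suc D) p q u w p≈q =
  cong₂ (λ a h → a * u ^ suc D + w * h) (p≈q (suc D)) (homog-≈ D p q u w p≈q)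

homog-zero : ∀ D p u w → p ≈ₚ [] → homog D p u w ≡ + 0
homog-zero zero    p u w p≈0 = p≈0 0
homog-zero (suc D) p u w p≈0 =
  trans (cong₂ (λ a h → a * u ^ suc D + w * h) (p≈0 (suc D)) (homog-zero D p u w p≈0))
        (vanish (u ^ suc D) w)
  where
  vanish : ∀ x w → + 0 * x + w * + 0 ≡ + 0
  vanish = solve-∀

homog-+ : ∀ D p q u w → homog D (p +ₚ q) u w ≡ homog D p u w + homog D q u w
homog-+ zero    p q u w = coeff-+ p q 0
homog-+ (suc D) p q u w =
  trans (cong₂ (λ a h → a * u ^ suc D + w * h) (coeff-+ p q (suc D)) (homog-+ D p q u w))
        (rearrange (coeff p (suc D)) (coeff q (suc D)) (u ^ suc D) w (homog D p u w) (homog D q u w))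
  where
  rearrange : ∀ a b x w h k → (a + b) * x + w * (h + k) ≡ (a * x + w * h) + (b * x + w * k)
  rearrange = solve-∀

homog-• : ∀ D c p u w → homog D (c •ₚ p) u w ≡ c * homog D p u w
homog-• zero    c p u w = coeff-• c p 0
homog-• (suc D) c p u w =
  trans (cong₂ (λ a h → a * u ^ suc D + w * h) (coeff-• c p (suc D)) (homog-• D c p u w))
        (rearrange c (coeff p (suc D)) (u ^ suc D) w (homog D p u w))
  where
  rearrange : ∀ c a x w h → (c * a) * x + w * (c * h) ≡ c * (a * x + w * h)
  rearrange = solve-∀

homog-∷ : ∀ D a p u w → homog (suc D) (a ∷ p) u w ≡ a * w ^ suc D + u * homog D p u w
homog-∷ zero    a p u w = rearrange (coeff p 0) u w a
  where
  rearrange : ∀ c u w a → c * (u * + 1) + w * a ≡ a * (w * + 1) + u * c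
  rearrange = solve-∀
homog-∷ (suc D) a p u w =
  trans (cong (λ h → coeff p (suc D) * u ^ suc (suc D) + w * h) (homog-∷ D a p u w))
        (rearrange (coeff p (suc D)) u w a (u ^ suc D) (w ^ suc D) (homog D p u w))
  where
  rearrange : ∀ c u w a uᴰ wᴰ h →
    c * (u * uᴰ) + w * (a * wᴰ + u * h) ≡ a * (w * wᴰ) + u * (c * uᴰ + w * h)
  rearrange = solve-∀

homog-const : ∀ D a u w → homog D (a ∷ []) u w ≡ a * w ^ D
homog-const zero    a u w = sym (ℤP.*-identityʳ a)
homog-const (suc D) a u w =
  trans (cong (λ h → + 0 * u ^ suc D + w * h) (homog-const D a u w))
        (rearrange (u ^ suc D) w a (w ^ D))
  where
  rearrange : ∀ x w a wᴰ → + 0 * x + w * (a * wᴰ) ≡ a * (w * wᴰ)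
  rearrange = solve-∀

homog-raise : ∀ D p u w → Deg≤ p D → homog (suc D) p u w ≡ w * homog D p u w
homog-raise D p u w deg =
  trans (cong (λ a → a * u ^ suc D + w * homog D p u w) (deg (suc D) ℕP.≤-refl))
        (vanish (u ^ suc D) (w * homog D p u w))
  where
  vanish : ∀ x y → + 0 * x + y ≡ y
  vanish = solve-∀

homog-raise-by : ∀ k D p u w → Deg≤ p D → homog (k ℕ.+ D) p u w ≡ w ^ k * homog D p u w
homog-raise-by zero    D p u w deg = sym (ℤP.*-identityˡ _)
homog-raise-by (suc k) D p u w deg = begin
  homog (suc (k ℕ.+ D)) p u w      ≡⟨ homog-raise (k ℕ.+ D) p u w (deg-mono p deg (ℕP.m≤n+m D k)) ⟩
  w * homog (k ℕ.+ D) p u w        ≡⟨ cong (w *_) (homog-raise-by k D p u w deg) ⟩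
  w * (w ^ k * homog D p u w)      ≡⟨ sym (ℤP.*-assoc w (w ^ k) _) ⟩
  w ^ suc k * homog D p u w        ∎
  where open ≡-Reasoning

homog-*-linear : ∀ D p q u w → Deg≤ p 1 → Deg≤ q D →
  homog (suc D) (p *ₚ q) u w ≡ homog 1 p u w * homog D q u w
homog-*-linear D []      q u w dp dq =
  trans (homog-zero (suc D) [] u w (λ _ → refl)) (sym (vanish u w (homog D q u w)))
  where
  vanish : ∀ u w h → (+ 0 * (u * + 1) + w * + 0) * h ≡ + 0
  vanish = solve-∀
homog-*-linear D (b ∷ p) q u w dp dq = begin
  homog (suc D) ((b •ₚ q) +ₚ (+ 0 ∷ (p *ₚ q))) u w
    ≡⟨ homog-+ (suc D) (b •ₚ q) (+ 0 ∷ (p *ₚ q)) u w ⟩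
  homog (suc D) (b •ₚ q) u w + homog (suc D) (+ 0 ∷ (p *ₚ q)) u w
    ≡⟨ cong₂ _+_ (homog-• (suc D) b q u w) (homog-∷ D (+ 0) (p *ₚ q) u w) ⟩
  b * homog (suc D) q u w + (+ 0 * w ^ suc D + u * homog D (p *ₚ q) u w)
    ≡⟨ cong₂ (λ h k → b * h + (+ 0 * w ^ suc D + u * k)) (homog-raise D q u w dq) p*q≡c•q ⟩
  b * (w * homog D q u w) + (+ 0 * w ^ suc D + u * (c * homog D q u w))
    ≡⟨ rearrange b w u c (w ^ suc D) (homog D q u w) ⟩
  (c * (u * + 1) + w * b) * homog D q u w ∎
  where
  open ≡-Reasoning
  c : ℤ
  c = coeff p 0
  p*q≡c•q : homog D (p *ₚ q) u w ≡ c * homog D q u w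
  p*q≡c•q = trans (homog-≈ D (p *ₚ q) (c •ₚ q) u w (*-deg0 p q (tail-deg dp))) (homog-• D c q u w)
  rearrange : ∀ b w u c wᴰ h →
    b * (w * h) + (+ 0 * wᴰ + u * (c * h)) ≡ (c * (u * + 1) + w * b) * h
  rearrange = solve-∀

homog-comp : ∀ D p q u w → Deg≤ p D → Deg≤ q 1 →
  homog D (comp p q) u w ≡ homog D p (homog 1 q u w) w
homog-comp D       []      q u w dp dq =
  trans (homog-zero D [] u w (λ _ → refl)) (sym (homog-zero D [] _ w (λ _ → refl)))
homog-comp zero    (a ∷ p) q u w dp dq =
  trans (coeff-+ (a ∷ []) (q *ₚ comp p q) 0)
        (trans (cong (_+_ a) (zero-*ʳ q (comp p q) (zero-comp p q (tail-zero dp)) 0)) (ℤP.+-identityʳ a))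
homog-comp (suc D) (a ∷ p) q u w dp dq = begin
  homog (suc D) ((a ∷ []) +ₚ (q *ₚ comp p q)) u w
    ≡⟨ homog-+ (suc D) (a ∷ []) (q *ₚ comp p q) u w ⟩
  homog (suc D) (a ∷ []) u w + homog (suc D) (q *ₚ comp p q) u w
    ≡⟨ cong₂ _+_ (homog-const (suc D) a u w)
                 (homog-*-linear D q (comp p q) u w dq (deg-comp p q D (tail-deg dp) dq)) ⟩
  a * w ^ suc D + y * homog D (comp p q) u w
    ≡⟨ cong (λ h → a * w ^ suc D + y * h) (homog-comp D p q u w (tail-deg dp) dq) ⟩
  a * w ^ suc D + y * homog D p y w
    ≡⟨ sym (homog-∷ D a p y w) ⟩
  homog (suc D) (a ∷ p) y w ∎
  where
  open ≡-Reasoning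
  y : ℤ
  y = homog 1 q u w

homog-scale : ∀ D p c u w → homog D p (c * u) (c * w) ≡ c ^ D * homog D p u w
homog-scale zero    p c u w = sym (ℤP.*-identityˡ _)
homog-scale (suc D) p c u w =
  trans (cong₂ (λ x h → coeff p (suc D) * x + (c * w) * h) (^-distrib-* c u (suc D)) (homog-scale D p c u w))
        (rearrange (coeff p (suc D)) c w (c ^ D) (u ^ suc D) (homog D p u w))
  where
  rearrange : ∀ a c w cᴰ x h → a * ((c * cᴰ) * x) + (c * w) * (cᴰ * h) ≡ (c * cᴰ) * (a * x + w * h)
  rearrange = solve-∀

homog-at-w0 : ∀ D p u → homog D p u (+ 0) ≡ coeff p D * u ^ D
homog-at-w0 zero    p u = sym (ℤP.*-identityʳ _)
homog-at-w0 (suc D) p u = ℤP.+-identityʳ _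

ev-homog : ∀ D p x → Deg≤ p D → ev p x ≡ homog D p x (+ 1)
ev-homog D       []      x deg = sym (homog-zero D [] x (+ 1) (λ _ → refl))
ev-homog zero    (a ∷ p) x deg =
  trans (cong (λ v → a + x * v) (ev-≈ p [] (tail-zero deg) x))
        (trans (cong (_+_ a) (ℤP.*-zeroʳ x)) (ℤP.+-identityʳ a))
ev-homog (suc D) (a ∷ p) x deg = begin
  a + x * ev p x                              ≡⟨ cong (λ v → a + x * v) (ev-homog D p x (tail-deg deg)) ⟩
  a + x * homog D p x (+ 1)
    ≡⟨ cong (λ v → v + x * homog D p x (+ 1))
            (sym (trans (cong (a *_) (ℤP.^-zeroˡ (suc D))) (ℤP.*-identityʳ a))) ⟩
  a * (+ 1) ^ suc D + x * homog D p x (+ 1)   ≡⟨ sym (homog-∷ D a p x (+ 1)) ⟩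
  homog (suc D) (a ∷ p) x (+ 1)               ∎
  where open ≡-Reasoning

reverse : ℕ → Poly → Poly
reverse zero    p = coeff p 0 ∷ []
reverse (suc D) p = coeff p (suc D) ∷ reverse D p

ev-reverse : ∀ D p y → ev (reverse D p) y ≡ homog D p (+ 1) y
ev-reverse zero    p y = trans (cong (_+_ (coeff p 0)) (ℤP.*-zeroʳ y)) (ℤP.+-identityʳ _)
ev-reverse (suc D) p y =
  cong₂ (λ a h → a + y * h) (sym one-power) (ev-reverse D p y)
  where
  one-power : coeff p (suc D) * (+ 1) ^ suc D ≡ coeff p (suc D)
  one-power = trans (cong (coeff p (suc D) *_) (ℤP.^-zeroˡ (suc D))) (ℤP.*-identityʳ _)

coeff-reverse : ∀ D p i → i ℕ.≤ D → coeff (reverse D p) i ≡ coeff p (D ∸ i)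
coeff-reverse zero    p zero    _         = refl
coeff-reverse (suc D) p zero    _         = refl
coeff-reverse (suc D) p (suc i) (s≤s i≤D) = coeff-reverse D p i i≤D

homog-expand : ∀ D p u w →
  homog D p u w ≡ coeff p 0 * w ^ D + ∑< D (λ k → coeff p (suc k) * u ^ suc k * w ^ (D ∸ suc k))
homog-expand zero    p u w = sym (trans (ℤP.+-identityʳ _) (ℤP.*-identityʳ _))
homog-expand (suc D) p u w = begin
  top + w * homog D p u w                        ≡⟨ cong (λ h → top + w * h) (homog-expand D p u w) ⟩
  top + w * (coeff p 0 * w ^ D + ∑< D term)      ≡⟨ rearrange top w (coeff p 0) (w ^ D) (∑< D term) ⟩
  coeff p 0 * w ^ suc D + (w * ∑< D term + top * w ^ 0)
    ≡⟨ cong₂ (λ x m → coeff p 0 * w ^ suc D + (x + top * w ^ m)) (sym shifted) (sym (ℕP.n∸n≡0 D)) ⟩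
  coeff p 0 * w ^ suc D + (∑< D term′ + term′ D) ≡⟨ cong (_+_ (coeff p 0 * w ^ suc D)) (sym (∑<-snoc D term′)) ⟩
  coeff p 0 * w ^ suc D + ∑< (suc D) term′       ∎
  where
  open ≡-Reasoning
  top : ℤ
  top = coeff p (suc D) * u ^ suc D
  term term′ : ℕ → ℤ
  term  k = coeff p (suc k) * u ^ suc k * w ^ (D ∸ suc k)
  term′ k = coeff p (suc k) * u ^ suc k * w ^ (suc D ∸ suc k)
  rearrange : ∀ a w c wᴰ s → a + w * (c * wᴰ + s) ≡ c * (w * wᴰ) + (w * s + a * + 1)
  rearrange = solve-∀
  shifted : ∑< D term′ ≡ w * ∑< D term
  shifted = trans (∑<-cong D λ k k<D →
                    trans (cong (λ m → coeff p (suc k) * u ^ suc k * w ^ m) (ℕP.+-∸-assoc 1 k<D))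
                          (move-w (coeff p (suc k) * u ^ suc k) w (w ^ (D ∸ suc k))))
                  (∑<-scale D w term)
    where
    move-w : ∀ a w x → a * (w * x) ≡ w * (a * x)
    move-w = solve-∀

homog-∑ₚ : ∀ D (P : ℕ → Poly) m (fn : ℕ → ℕ) u w →
  homog D (∑ₚ P (applyUpTo fn m)) u w ≡ ∑< m (λ j → homog D (P (fn j)) u w)
homog-∑ₚ D P zero    fn u w = homog-zero D [] u w (λ _ → refl)
homog-∑ₚ D P (suc m) fn u w =
  trans (homog-+ D (P (fn 0)) _ u w) (cong (_+_ (homog D (P (fn 0)) u w)) (homog-∑ₚ D P m (λ j → fn (suc j)) u w))

homog-x-1-power : ∀ m u w → homog m (x-1 ^ₚ m) u w ≡ (u - w) ^ m
homog-x-1-power zero    u w = refl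
homog-x-1-power (suc m) u w =
  trans (homog-*-linear m x-1 (x-1 ^ₚ m) u w deg-x-1 (deg-^ x-1 m deg-x-1))
        (cong₂ _*_ (normalise u w) (homog-x-1-power m u w))
  where
  normalise : ∀ u w → + 1 * (u * + 1) + w * -[1+ 0 ] ≡ u - w
  normalise = solve-∀

homog-x-1-power-raised : ∀ k m u w → homog (k ℕ.+ m) (x-1 ^ₚ m) u w ≡ w ^ k * (u - w) ^ m
homog-x-1-power-raised k m u w =
  trans (homog-raise-by k m (x-1 ^ₚ m) u w (deg-^ x-1 m deg-x-1)) (cong (w ^ k *_) (homog-x-1-power m u w))

-- Defs.hPoly of a complex with D-1 as dimension and face numbers c:
-- the h-polynomial (x-1)^D + Σ_{k<D} c_k (x-1)^(D-1-k).
hPolyOf : ℕ → (ℕ → ℤ) → Poly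
hPolyOf D c = (x-1 ^ₚ D) +ₚ ∑ₚ (λ k → c k •ₚ (x-1 ^ₚ (D ∸ suc k))) (upTo D)

deg-hPolyOf : ∀ D c → Deg≤ (hPolyOf D c) D
deg-hPolyOf D c =
  deg-+ (x-1 ^ₚ D) _ D (deg-^ x-1 D deg-x-1)
        (deg-∑ₚ _ (upTo D) D λ k → deg-• (c k) (x-1 ^ₚ (D ∸ suc k)) D
          (deg-mono (x-1 ^ₚ (D ∸ suc k)) (deg-^ x-1 (D ∸ suc k) deg-x-1) (ℕP.m∸n≤m D (suc k))))

homog-hPolyOf : ∀ D c F u w → coeff F 0 ≡ + 1 → (∀ k → k ℕ.< D → coeff F (suc k) ≡ c k) →
  homog D (hPolyOf D c) u w ≡ homog D F w (u - w)
homog-hPolyOf D c F u w F₀≡1 F≡c = begin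
  homog D (hPolyOf D c) u w
    ≡⟨ homog-+ D (x-1 ^ₚ D) _ u w ⟩
  homog D (x-1 ^ₚ D) u w + homog D (∑ₚ term (upTo D)) u w
    ≡⟨ cong₂ _+_ (homog-x-1-power D u w) (homog-∑ₚ D term D (λ k → k) u w) ⟩
  (u - w) ^ D + ∑< D (λ k → homog D (term k) u w)
    ≡⟨ cong₂ _+_ (sym (trans (cong (_* (u - w) ^ D) F₀≡1) (ℤP.*-identityˡ _))) (∑<-cong D term-value) ⟩
  coeff F 0 * (u - w) ^ D + ∑< D (λ k → coeff F (suc k) * w ^ suc k * (u - w) ^ (D ∸ suc k))
    ≡⟨ sym (homog-expand D F w (u - w)) ⟩
  homog D F w (u - w) ∎
  where
  open ≡-Reasoning
  term : ℕ → Poly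
  term k = c k •ₚ (x-1 ^ₚ (D ∸ suc k))
  term-value : ∀ k → k ℕ.< D →
    homog D (term k) u w ≡ coeff F (suc k) * w ^ suc k * (u - w) ^ (D ∸ suc k)
  term-value k k<D = begin
    homog D (term k) u w
      ≡⟨ homog-• D (c k) (x-1 ^ₚ (D ∸ suc k)) u w ⟩
    c k * homog D (x-1 ^ₚ (D ∸ suc k)) u w
      ≡⟨ cong (λ m → c k * homog m (x-1 ^ₚ (D ∸ suc k)) u w) (sym (ℕP.m+[n∸m]≡n k<D)) ⟩
    c k * homog (suc k ℕ.+ (D ∸ suc k)) (x-1 ^ₚ (D ∸ suc k)) u w
      ≡⟨ cong (c k *_) (homog-x-1-power-raised (suc k) (D ∸ suc k) u w) ⟩
    c k * (w ^ suc k * (u - w) ^ (D ∸ suc k))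
      ≡⟨ sym (ℤP.*-assoc (c k) _ _) ⟩
    c k * w ^ suc k * (u - w) ^ (D ∸ suc k)
      ≡⟨ cong (λ a → a * w ^ suc k * (u - w) ^ (D ∸ suc k)) (sym (F≡c k k<D)) ⟩
    coeff F (suc k) * w ^ suc k * (u - w) ^ (D ∸ suc k) ∎

homogenised-FunEq : ∀ D s F → Deg≤ F D → FunEq s F →
  ∀ y → homog D F (+ 1) y + s * homog D F (-[1+ 0 ] - y) y ≡ + 0
homogenised-FunEq D s F deg fe y = begin
  homog D F (+ 1) y + s * homog D F (-[1+ 0 ] - y) y
    ≡⟨ cong (λ v → homog D F (+ 1) y + s * homog D F v y) (sym (reflected y)) ⟩
  homog D F (+ 1) y + s * homog D F (homog 1 reflection (+ 1) y) y
    ≡⟨ cong (λ v → homog D F (+ 1) y + s * v) (sym (homog-comp D F reflection (+ 1) y deg deg-reflection)) ⟩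
  homog D F (+ 1) y + s * homog D (comp F reflection) (+ 1) y
    ≡⟨ cong (_+_ (homog D F (+ 1) y)) (sym (homog-• D s (comp F reflection) (+ 1) y)) ⟩
  homog D F (+ 1) y + homog D (s •ₚ comp F reflection) (+ 1) y
    ≡⟨ sym (homog-+ D F (s •ₚ comp F reflection) (+ 1) y) ⟩
  homog D (symmetrised s F) (+ 1) y
    ≡⟨ homog-zero D (symmetrised s F) (+ 1) y (FunEq⇒symmetrised-zero s F fe) ⟩
  + 0 ∎
  where
  open ≡-Reasoning
  reflected : ∀ y → homog 1 reflection (+ 1) y ≡ -[1+ 0 ] - y
  reflected y = normalise y
    where
    normalise : ∀ y → -[1+ 0 ] * (+ 1 * + 1) + y * -[1+ 0 ] ≡ -[1+ 0 ] - y
    normalise = solve-∀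

-- Comparing top coefficients (y = 0) in the homogenised equation: s·(-1)^D = -1
-- whenever F_D ≠ 0.
FunEq-sign : ∀ D s F → Deg≤ F D → coeff F D ≢ + 0 → FunEq s F → + 1 + s * -[1+ 0 ] ^ D ≡ + 0
FunEq-sign D s F deg top≢0 fe with ℤP.i*j≡0⇒i≡0∨j≡0 (coeff F D) top-coefficient
  where
  e : ℤ
  e = -[1+ 0 ] ^ D
  expand : ∀ a s e → a * (+ 1 + s * e) ≡ a * + 1 + s * (a * e)
  expand = solve-∀
  top-coefficient : coeff F D * (+ 1 + s * e) ≡ + 0
  top-coefficient = begin
    coeff F D * (+ 1 + s * e)                             ≡⟨ expand (coeff F D) s e ⟩
    coeff F D * + 1 + s * (coeff F D * e)
      ≡⟨ cong (λ v → coeff F D * v + s * (coeff F D * e)) (sym (ℤP.^-zeroˡ D)) ⟩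
    coeff F D * (+ 1) ^ D + s * (coeff F D * e)
      ≡⟨ cong₂ (λ a b → a + s * b) (sym (homog-at-w0 D F (+ 1))) (sym (homog-at-w0 D F -[1+ 0 ])) ⟩
    homog D F (+ 1) (+ 0) + s * homog D F -[1+ 0 ] (+ 0) ≡⟨ homogenised-FunEq D s F deg fe (+ 0) ⟩
    + 0                                                   ∎
    where open ≡-Reasoning
... | inj₁ top≡0  = ⊥-elim (top≢0 top≡0)
... | inj₂ sign≡0 = sign≡0

-- The homogenised
-- equation gives F(1, x-1) = -s·F(-x, x-1), and F(-x, x-1) = (-1)^D·F(x, 1-x).
reciprocity : ∀ D s F → Deg≤ F D → coeff F D ≢ + 0 → FunEq s F →
  ∀ x → homog D F (+ 1) (x - + 1) ≡ homog D F x (+ 1 - x)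
reciprocity D s F deg top≢0 fe x = begin
  homog D F (+ 1) (x - + 1)
    ≡⟨ sum-zero⇒≡-neg _ _ (homogenised-FunEq D s F deg fe (x - + 1)) ⟩
  - (s * homog D F (-[1+ 0 ] - (x - + 1)) (x - + 1))
    ≡⟨ cong₂ (λ u v → - (s * homog D F u v)) (flip-u x) (flip-w x) ⟩
  - (s * homog D F (-[1+ 0 ] * x) (-[1+ 0 ] * (+ 1 - x)))
    ≡⟨ cong (λ v → - (s * v)) (homog-scale D F -[1+ 0 ] x (+ 1 - x)) ⟩
  - (s * (-[1+ 0 ] ^ D * v))
    ≡⟨ split s (-[1+ 0 ] ^ D) v ⟩
  v + - ((+ 1 + s * -[1+ 0 ] ^ D) * v)
    ≡⟨ cong (λ c → v + - (c * v)) (FunEq-sign D s F deg top≢0 fe) ⟩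
  v + - (+ 0 * v)
    ≡⟨ vanish v ⟩
  v ∎
  where
  open ≡-Reasoning
  v : ℤ
  v = homog D F x (+ 1 - x)
  flip-u : ∀ x → -[1+ 0 ] - (x - + 1) ≡ -[1+ 0 ] * x
  flip-u = solve-∀
  flip-w : ∀ x → x - + 1 ≡ -[1+ 0 ] * (+ 1 - x)
  flip-w = solve-∀
  split : ∀ s e v → - (s * (e * v)) ≡ v + - ((+ 1 + s * e) * v)
  split = solve-∀
  vanish : ∀ v → v + - (+ 0 * v) ≡ v
  vanish = solve-∀

-- Both h(x) and its reversal x^D h(1/x)
-- are homogenisations of F, which agree by reciprocity.
hPolyOf-palindromic : ∀ D s c F → Deg≤ F D → coeff F D ≢ + 0 → FunEq s F →
  coeff F 0 ≡ + 1 → (∀ k → k ℕ.< D → coeff F (suc k) ≡ c k) →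
  ∀ i → i ℕ.≤ D → coeff (hPolyOf D c) i ≡ coeff (hPolyOf D c) (D ∸ i)
hPolyOf-palindromic D s c F deg top≢0 fe F₀≡1 F≡c i i≤D =
  trans (≈-by-ev hp (reverse D hp) same-values i) (coeff-reverse D hp i i≤D)
  where
  open ≡-Reasoning
  hp : Poly
  hp = hPolyOf D c
  same-values : ∀ x → ev hp x ≡ ev (reverse D hp) x
  same-values x = begin
    ev hp x                      ≡⟨ ev-homog D hp x (deg-hPolyOf D c) ⟩
    homog D hp x (+ 1)           ≡⟨ homog-hPolyOf D c F x (+ 1) F₀≡1 F≡c ⟩
    homog D F (+ 1) (x - + 1)   ≡⟨ reciprocity D s F deg top≢0 fe x ⟩
    homog D F x (+ 1 - x)       ≡⟨ sym (homog-hPolyOf D c F (+ 1) x F₀≡1 F≡c) ⟩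
    homog D hp (+ 1) x           ≡⟨ sym (ev-reverse D hp x) ⟩
    ev (reverse D hp) x          ∎

ind : Bool → ℕ
ind true  = 1
ind false = 0

sumBy : {X : Set} → (X → ℕ) → List X → ℕ
sumBy g []       = 0
sumBy g (x ∷ xs) = g x ℕ.+ sumBy g xs

sumBy-cong : ∀ {X : Set} {g h : X → ℕ} xs → (∀ x → g x ≡ h x) → sumBy g xs ≡ sumBy h xs
sumBy-cong []       eq = refl
sumBy-cong (x ∷ xs) eq = cong₂ ℕ._+_ (eq x) (sumBy-cong xs eq)

sumBy-zero : ∀ {X : Set} (xs : List X) → sumBy (λ _ → 0) xs ≡ 0
sumBy-zero []       = refl
sumBy-zero (x ∷ xs) = sumBy-zero xs

sumBy-++ : ∀ {X : Set} (g : X → ℕ) xs ys → sumBy g (xs ++ ys) ≡ sumBy g xs ℕ.+ sumBy g ys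
sumBy-++ g []       ys = refl
sumBy-++ g (x ∷ xs) ys = trans (cong (g x ℕ.+_) (sumBy-++ g xs ys)) (sym (ℕP.+-assoc (g x) _ _))

sumBy-map : ∀ {X Y : Set} (g : Y → ℕ) (fn : X → Y) xs → sumBy g (map fn xs) ≡ sumBy (λ x → g (fn x)) xs
sumBy-map g fn []       = refl
sumBy-map g fn (x ∷ xs) = cong (g (fn x) ℕ.+_) (sumBy-map g fn xs)

sumBy-scale : ∀ {X : Set} k (g : X → ℕ) xs → sumBy (λ x → k ℕ.* g x) xs ≡ k ℕ.* sumBy g xs
sumBy-scale k g []       = sym (ℕP.*-zeroʳ k)
sumBy-scale k g (x ∷ xs) = trans (cong (k ℕ.* g x ℕ.+_) (sumBy-scale k g xs)) (sym (ℕP.*-distribˡ-+ k (g x) _))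

sumBy-+ : ∀ {X : Set} (g h : X → ℕ) xs → sumBy (λ x → g x ℕ.+ h x) xs ≡ sumBy g xs ℕ.+ sumBy h xs
sumBy-+ g h []       = refl
sumBy-+ g h (x ∷ xs) = trans (cong (g x ℕ.+ h x ℕ.+_) (sumBy-+ g h xs)) (ℕ+.interchange (g x) (h x) _ _)

sumBy-scaleʳ : ∀ {X : Set} k (g : X → ℕ) xs → sumBy g xs ℕ.* k ≡ sumBy (λ x → g x ℕ.* k) xs
sumBy-scaleʳ k g xs =
  trans (ℕP.*-comm (sumBy g xs) k) (trans (sym (sumBy-scale k g xs)) (sumBy-cong xs (λ x → ℕP.*-comm k (g x))))

sumBy-swap : ∀ {X Y : Set} (g : X → Y → ℕ) xs ys →
  sumBy (λ x → sumBy (g x) ys) xs ≡ sumBy (λ y → sumBy (λ x → g x y) xs) ys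
sumBy-swap g []       ys = sym (sumBy-zero ys)
sumBy-swap g (x ∷ xs) ys =
  trans (cong (sumBy (g x) ys ℕ.+_) (sumBy-swap g xs ys)) (sym (sumBy-+ (g x) _ ys))

length-filter : ∀ {X : Set} (p : X → Bool) xs → length (filterᵇ p xs) ≡ sumBy (λ x → ind (p x)) xs
length-filter p []       = refl
length-filter p (x ∷ xs) with p x
... | true  = cong suc (length-filter p xs)
... | false = length-filter p xs

sumBy-filter : ∀ {X : Set} (p : X → Bool) (g : X → ℕ) xs →
  sumBy g (filterᵇ p xs) ≡ sumBy (λ x → ind (p x) ℕ.* g x) xs
sumBy-filter p g []       = refl
sumBy-filter p g (x ∷ xs) with p x
... | true  = cong₂ ℕ._+_ (sym (ℕP.+-identityʳ (g x))) (sumBy-filter p g xs)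
... | false = sumBy-filter p g xs

sumBy-allFin-suc : ∀ {m} (g : Fin (suc m) → ℕ) →
  sumBy g (allFin (suc m)) ≡ g Fin.zero ℕ.+ sumBy (λ x → g (Fin.suc x)) (allFin m)
sumBy-allFin-suc {m} g =
  cong (g Fin.zero ℕ.+_) (trans (cong (sumBy g) (sym (ListP.map-tabulate (λ x → x) Fin.suc)))
                               (sumBy-map g Fin.suc (allFin m)))

sumBy-allSubsets-suc : ∀ {m} (g : Subset (suc m) → ℕ) →
  sumBy g (allSubsets (suc m)) ≡
  sumBy (λ C → g (true ∷ C)) (allSubsets m) ℕ.+ sumBy (λ C → g (false ∷ C)) (allSubsets m)
sumBy-allSubsets-suc {m} g =
  trans (sumBy-++ g (map (true ∷_) (allSubsets m)) (map (false ∷_) (allSubsets m)))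
        (cong₂ ℕ._+_ (sumBy-map g (true ∷_) (allSubsets m)) (sumBy-map g (false ∷_) (allSubsets m)))

∣∣-as-sum : ∀ {m} (C : Subset m) → ∣ C ∣ ≡ sumBy (λ x → ind (lookup C x)) (allFin m)
∣∣-as-sum []          = refl
∣∣-as-sum (true ∷ C)  =
  trans (cong suc (∣∣-as-sum C)) (sym (sumBy-allFin-suc (λ x → ind (lookup (true ∷ C) x))))
∣∣-as-sum (false ∷ C) = trans (∣∣-as-sum C) (sym (sumBy-allFin-suc (λ x → ind (lookup (false ∷ C) x))))

∣insert∣ : ∀ {m} (x : Fin m) (C : Subset m) → lookup C x ≡ false → ∣ C [ x ]≔ true ∣ ≡ suc ∣ C ∣
∣insert∣ Fin.zero    (false ∷ C) _  = refl
∣insert∣ (Fin.suc x) (true ∷ C)  Cx = cong suc (∣insert∣ x C Cx)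
∣insert∣ (Fin.suc x) (false ∷ C) Cx = ∣insert∣ x C Cx

-- Membership in D ∪ {x}, which is written D [ x ]≔ true.
insert-⊇ : ∀ {m} (x y : Fin m) D → lookup D y ≡ true → lookup (D [ x ]≔ true) y ≡ true
insert-⊇ x y D Dy with x Fin.≟ y
... | yes refl = VecP.lookup∘update x D true
... | no  x≢y  = trans (VecP.lookup∘update′ (λ y≡x → x≢y (sym y≡x)) D true) Dy

insert-other : ∀ {m} (x y : Fin m) D → lookup (D [ x ]≔ true) y ≡ true → x ≢ y → lookup D y ≡ true
insert-other x y D D⁺y x≢y = trans (sym (VecP.lookup∘update′ (λ y≡x → x≢y (sym y≡x)) D true)) D⁺y

sum-containing : ∀ {m} (x : Fin m) (g : Subset m → ℕ) →
  sumBy (λ C → ind (lookup C x) ℕ.* g C) (allSubsets m) ≡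
  sumBy (λ D → ind (not (lookup D x)) ℕ.* g (D [ x ]≔ true)) (allSubsets m)
sum-containing {suc m} x g =
  trans (sumBy-allSubsets-suc containing) (trans (split x g) (sym (sumBy-allSubsets-suc avoiding)))
  where
  containing avoiding : Subset (suc m) → ℕ
  containing C = ind (lookup C x) ℕ.* g C
  avoiding   D = ind (not (lookup D x)) ℕ.* g (D [ x ]≔ true)
  S : List (Subset m)
  S = allSubsets m
  split : ∀ y (g : Subset (suc m) → ℕ) →
    sumBy (λ C → ind (lookup (true ∷ C) y) ℕ.* g (true ∷ C)) S ℕ.+
    sumBy (λ C → ind (lookup (false ∷ C) y) ℕ.* g (false ∷ C)) S ≡
    sumBy (λ D → ind (not (lookup (true ∷ D) y)) ℕ.* g ((true ∷ D) [ y ]≔ true)) S ℕ.+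
    sumBy (λ D → ind (not (lookup (false ∷ D) y)) ℕ.* g ((false ∷ D) [ y ]≔ true)) S
  split Fin.zero    g = ℕP.+-comm (sumBy (λ C → 1 ℕ.* g (true ∷ C)) S) (sumBy (λ _ → 0) S)
  split (Fin.suc y) g =
    cong₂ ℕ._+_ (sum-containing y (λ C → g (true ∷ C))) (sum-containing y (λ C → g (false ∷ C)))

sum-size-zero : ∀ {m} (g : Subset m → ℕ) →
  sumBy (λ C → g C ℕ.* ind (∣ C ∣ ≡ᵇ 0)) (allSubsets m) ≡ g (replicate m false)
sum-size-zero {zero}  g = trans (ℕP.+-identityʳ _) (ℕP.*-identityʳ (g []))
sum-size-zero {suc m} g =
  trans (sumBy-allSubsets-suc (λ C → g C ℕ.* ind (∣ C ∣ ≡ᵇ 0)))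
        (cong₂ ℕ._+_ (trans (sumBy-cong (allSubsets m) (λ C → ℕP.*-zeroʳ (g (true ∷ C))))
                            (sumBy-zero (allSubsets m)))
                     (sum-size-zero (λ C → g (false ∷ C))))

size-weight : ∀ m k b → suc k ℕ.* (b ℕ.* ind (m ≡ᵇ suc k)) ≡ m ℕ.* (b ℕ.* ind (m ≡ᵇ suc k))
size-weight m k b with m ≡ᵇ suc k in m≡
... | true  = cong (λ m′ → m′ ℕ.* (b ℕ.* 1)) (sym (ℕP.≡ᵇ⇒≡ m (suc k) (subst T (sym m≡) tt)))
... | false rewrite ℕP.*-zeroʳ b = trans (ℕP.*-zeroʳ (suc k)) (sym (ℕP.*-zeroʳ m))

coeff-∑ₚ : ∀ {X : Set} (P : X → Poly) xs i (c : X → ℕ) → (∀ x → coeff (P x) i ≡ + c x) →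
  coeff (∑ₚ P xs) i ≡ + sumBy c xs
coeff-∑ₚ P []       i c eq = refl
coeff-∑ₚ P (x ∷ xs) i c eq =
  trans (coeff-+ (P x) (∑ₚ P xs) i) (trans (cong₂ _+_ (eq x) (coeff-∑ₚ P xs i c eq)) (sym (ℤP.pos-+ (c x) _)))

lastNonzero : (ℕ → ℕ) → ℕ → ℕ
lastNonzero g m = foldl (λ acc k → if g k ≡ᵇ 0 then acc else suc k) 0 (upTo m)

lastNonzero-suc : ∀ g m → lastNonzero g (suc m) ≡ (if g m ≡ᵇ 0 then lastNonzero g m else suc m)
lastNonzero-suc g m =
  trans (cong (foldl step 0) (sym (ListP.applyUpTo-∷ʳ (λ k → k) m))) (ListP.foldl-∷ʳ step 0 m (upTo m))
  where
  step : ℕ → ℕ → ℕ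
  step acc k = if g k ≡ᵇ 0 then acc else suc k

zero-beyond-lastNonzero : ∀ g m k → lastNonzero g m ℕ.≤ k → k ℕ.< m → g k ≡ 0
zero-beyond-lastNonzero g (suc m) k last≤k k<m rewrite lastNonzero-suc g m with g m ≡ᵇ 0 in gm≡0
... | false = ⊥-elim (ℕP.<-irrefl refl (ℕP.≤-trans k<m last≤k))
... | true with ℕP.m<1+n⇒m<n∨m≡n k<m
...   | inj₁ k<m′   = zero-beyond-lastNonzero g m k last≤k k<m′
...   | inj₂ refl   = ℕP.≡ᵇ⇒≡ (g k) 0 (subst T (sym gm≡0) tt)

lastNonzero-attained : ∀ g m → lastNonzero g m ≡ 0 ⊎ Σ ℕ (λ k → lastNonzero g m ≡ suc k × g k ≢ 0)
lastNonzero-attained g zero    = inj₁ refl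
lastNonzero-attained g (suc m) rewrite lastNonzero-suc g m with g m ≡ᵇ 0 in gm≡0
... | true  = lastNonzero-attained g m
... | false = inj₂ (m , refl , λ gm≡0′ → case trans (sym gm≡0) (cong (_≡ᵇ 0) gm≡0′) of λ ())

allᵇ-sound : ∀ {X : Set} (p : X → Bool) xs → allᵇ p xs ≡ true → ∀ x → x ∈ xs → p x ≡ true
allᵇ-sound p (y ∷ xs) all x x∈ with p y in py
allᵇ-sound p (y ∷ xs) all x (here refl) | true = py
allᵇ-sound p (y ∷ xs) all x (there x∈) | true = allᵇ-sound p xs all x x∈

allᵇ-complete : ∀ {X : Set} (p : X → Bool) xs → (∀ x → p x ≡ true) → allᵇ p xs ≡ true
allᵇ-complete p []       all = refl
allᵇ-complete p (x ∷ xs) all rewrite all x = allᵇ-complete p xs all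

allᵇ-allFin : ∀ {m} (p : Fin m → Bool) → allᵇ p (allFin m) ≡ true → ∀ x → p x ≡ true
allᵇ-allFin p all x = allᵇ-sound p _ all x (∈-allFin x)

∧-elimˡ : ∀ {a b} → a ∧ b ≡ true → a ≡ true
∧-elimˡ {true} _ = refl

∧-elimʳ : ∀ {a b} → a ∧ b ≡ true → b ≡ true
∧-elimʳ {true} b≡true = b≡true

∧-intro : ∀ {a b} → a ≡ true → b ≡ true → a ∧ b ≡ true
∧-intro refl refl = refl

⇒ᵇ-elim : ∀ a b → not a ∨ b ≡ true → a ≡ true → b ≡ true
⇒ᵇ-elim true b b≡true refl = b≡true

⇒ᵇ-intro : ∀ a b → (a ≡ true → b ≡ true) → not a ∨ b ≡ true
⇒ᵇ-intro true  b imp = imp refl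
⇒ᵇ-intro false b imp = refl

pair-elim : ∀ {P : Set} a b c (d : Dec P) →
  not (a ∧ b ∧ not ⌊ d ⌋) ∨ c ≡ true → a ≡ true → b ≡ true → ¬ P → c ≡ true
pair-elim true true c (no _)  c≡true refl refl _  = c≡true
pair-elim true true c (yes p) _      refl refl ¬p = ⊥-elim (¬p p)

pair-intro : ∀ {P : Set} a b c (d : Dec P) →
  (a ≡ true → b ≡ true → ¬ P → c ≡ true) → not (a ∧ b ∧ not ⌊ d ⌋) ∨ c ≡ true
pair-intro false b     c d        imp = refl
pair-intro true  false c d        imp = refl
pair-intro true  true  c (yes p)  imp = refl
pair-intro true  true  c (no ¬p)  imp = imp refl refl ¬p

bool-ext : ∀ {b b′ : Bool} → (b ≡ true → b′ ≡ true) → (b′ ≡ true → b ≡ true) → b ≡ b′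
bool-ext {true}          to from = sym (to refl)
bool-ext {false} {true}  to from = from refl
bool-ext {false} {false} to from = refl

module _ (G : Graph) where

  IsClique : Subset (n G) → Subset (n G) → Set
  IsClique U C = (∀ x → lookup C x ≡ true → lookup U x ≡ true)
               × (∀ x y → lookup C x ≡ true → lookup C y ≡ true → x ≢ y → adj G x y ≡ true)

  isCliqueᵇ-sound : ∀ U C → isCliqueᵇ G U C ≡ true → IsClique U C
  isCliqueᵇ-sound U C test =
    (λ x → ⇒ᵇ-elim (lookup C x) (lookup U x) (allᵇ-allFin _ (∧-elimˡ test) x)) ,
    (λ x y → pair-elim (lookup C x) (lookup C y) (adj G x y) (x Fin.≟ y)
                       (allᵇ-allFin _ (allᵇ-allFin _ (∧-elimʳ test) x) y))

  isCliqueᵇ-complete : ∀ U C → IsClique U C → isCliqueᵇ G U C ≡ true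
  isCliqueᵇ-complete U C (C⊆U , complete) =
    ∧-intro (allᵇ-complete _ (allFin (n G)) (λ x → ⇒ᵇ-intro (lookup C x) (lookup U x) (C⊆U x)))
            (allᵇ-complete _ (allFin (n G)) λ x → allᵇ-complete _ (allFin (n G)) λ y →
               pair-intro (lookup C x) (lookup C y) (adj G x y) (x Fin.≟ y) (complete x y))

  lookup-sphere : ∀ U x y → lookup (sphere G U x) y ≡ lookup U y ∧ adj G x y
  lookup-sphere U x y =
    trans (VecP.lookup-zipWith _∧_ y U (tabulate (adj G x))) (cong (lookup U y ∧_) (VecP.lookup∘tabulate (adj G x) y))

  clique⊆ : ∀ U C x → isCliqueᵇ G U C ≡ true → lookup C x ≡ true → lookup U x ≡ true
  clique⊆ U C x test = proj₁ (isCliqueᵇ-sound U C test) x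

  outside-clique : ∀ U C x → lookup U x ≡ false → lookup C x ≡ true → isCliqueᵇ G U C ≡ false
  outside-clique U C x Ux Cx = BoolP.¬-not λ test → case trans (sym Ux) (clique⊆ U C x test Cx) of λ ()

  -- No clique of the unit sphere S(x) contains x, as G has no loops.
  sphere-clique-avoids : ∀ U x D → lookup D x ≡ true → isCliqueᵇ G (sphere G U x) D ≡ false
  sphere-clique-avoids U x D Dx = outside-clique (sphere G U x) D x x∉S Dx
    where
    x∉S : lookup (sphere G U x) x ≡ false
    x∉S = trans (lookup-sphere U x x) (trans (cong (lookup U x ∧_) (adj-irrefl G x)) (BoolP.∧-zeroʳ (lookup U x)))

  cone-clique : ∀ U x D → lookup U x ≡ true → lookup D x ≡ false →
    isCliqueᵇ G U (D [ x ]≔ true) ≡ isCliqueᵇ G (sphere G U x) D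
  cone-clique U x D Ux Dx = bool-ext to from
    where
    D⁺ : Subset (n G)
    D⁺ = D [ x ]≔ true
    x∈D⁺ : lookup D⁺ x ≡ true
    x∈D⁺ = VecP.lookup∘update x D true
    D⊆D⁺ : ∀ y → lookup D y ≡ true → lookup D⁺ y ≡ true
    D⊆D⁺ y = insert-⊇ x y D
    D⁺-other : ∀ y → lookup D⁺ y ≡ true → x ≢ y → lookup D y ≡ true
    D⁺-other y = insert-other x y D
    x∉D : ∀ y → lookup D y ≡ true → x ≢ y
    x∉D y Dy refl = case trans (sym Dx) Dy of λ ()
    to : isCliqueᵇ G U D⁺ ≡ true → isCliqueᵇ G (sphere G U x) D ≡ true
    to test with isCliqueᵇ-sound U D⁺ test
    ... | D⁺⊆U , complete =
      isCliqueᵇ-complete (sphere G U x) D (D⊆S , λ y z Dy Dz → complete y z (D⊆D⁺ y Dy) (D⊆D⁺ z Dz))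
      where
      D⊆S : ∀ y → lookup D y ≡ true → lookup (sphere G U x) y ≡ true
      D⊆S y Dy = trans (lookup-sphere U x y)
                       (∧-intro (D⁺⊆U y (D⊆D⁺ y Dy)) (complete x y x∈D⁺ (D⊆D⁺ y Dy) (x∉D y Dy)))
    from : isCliqueᵇ G (sphere G U x) D ≡ true → isCliqueᵇ G U D⁺ ≡ true
    from test with isCliqueᵇ-sound (sphere G U x) D test
    ... | D⊆S , complete = isCliqueᵇ-complete U D⁺ (D⁺⊆U , complete⁺)
      where
      adj-x : ∀ y → lookup D y ≡ true → adj G x y ≡ true
      adj-x y Dy = ∧-elimʳ (trans (sym (lookup-sphere U x y)) (D⊆S y Dy))
      D⁺⊆U : ∀ y → lookup D⁺ y ≡ true → lookup U y ≡ true
      D⁺⊆U y D⁺y with x Fin.≟ y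
      ... | yes refl = Ux
      ... | no x≢y   = ∧-elimˡ (trans (sym (lookup-sphere U x y)) (D⊆S y (D⁺-other y D⁺y x≢y)))
      complete⁺ : ∀ y z → lookup D⁺ y ≡ true → lookup D⁺ z ≡ true → y ≢ z → adj G y z ≡ true
      complete⁺ y z D⁺y D⁺z y≢z with x Fin.≟ y | x Fin.≟ z
      ... | yes refl | yes refl = ⊥-elim (y≢z refl)
      ... | yes refl | no x≢z   = adj-x z (D⁺-other z D⁺z x≢z)
      ... | no x≢y   | yes refl = trans (adj-sym G y x) (adj-x y (D⁺-other y D⁺y x≢y))
      ... | no x≢y   | no x≢z   = complete y z (D⁺-other y D⁺y x≢y) (D⁺-other z D⁺z x≢z) y≢z

  empty-clique : ∀ U → isCliqueᵇ G U (replicate (n G) false) ≡ true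
  empty-clique U =
    isCliqueᵇ-complete U (replicate (n G) false)
      ((λ x x∈ → ⊥-elim (not-member x x∈)) , (λ x y x∈ _ _ → ⊥-elim (not-member x x∈)))
    where
    not-member : ∀ x → lookup (replicate (n G) false) x ≢ true
    not-member x e with trans (sym (VecP.lookup-replicate x false)) e
    ... | ()

  -- The number of complete subgraphs of G[U] with j vertices, so f G U k = cliqueCount U (suc k).
  cliqueCount : Subset (n G) → ℕ → ℕ
  cliqueCount U j = length (filterᵇ (λ C → ∣ C ∣ ≡ᵇ j) (cliques G U))

  cliqueOfSize : Subset (n G) → ℕ → Subset (n G) → ℕ
  cliqueOfSize U j C = ind (isCliqueᵇ G U C) ℕ.* ind (∣ C ∣ ≡ᵇ j)

  cliqueCount-as-sum : ∀ U j → cliqueCount U j ≡ sumBy (cliqueOfSize U j) (allSubsets (n G))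
  cliqueCount-as-sum U j =
    trans (length-filter _ (cliques G U)) (sumBy-filter (isCliqueᵇ G U) _ (allSubsets (n G)))

  cliqueCount-zero : ∀ U → cliqueCount U 0 ≡ 1
  cliqueCount-zero U =
    trans (cliqueCount-as-sum U 0) (trans (sum-size-zero (λ C → ind (isCliqueᵇ G U C))) (cong ind (empty-clique U)))

  cliqueCount-large : ∀ U j → n G ℕ.< j → cliqueCount U j ≡ 0
  cliqueCount-large U j n<j =
    trans (cliqueCount-as-sum U j) (trans (sumBy-cong (allSubsets (n G)) too-large) (sumBy-zero (allSubsets (n G))))
    where
    too-large : ∀ C → cliqueOfSize U j C ≡ 0
    too-large C with ∣ C ∣ ≡ᵇ j in size≡j
    ... | false = ℕP.*-zeroʳ (ind (isCliqueᵇ G U C))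
    ... | true  = ⊥-elim (ℕP.<⇒≢ (ℕP.≤-<-trans (SubsetP.∣p∣≤n C) n<j)
                                  (ℕP.≡ᵇ⇒≡ ∣ C ∣ j (subst T (sym size≡j) tt)))

  cliques-through : ∀ U x j →
    sumBy (λ C → ind (lookup C x) ℕ.* cliqueOfSize U (suc j) C) (allSubsets (n G)) ≡
    ind (lookup U x) ℕ.* cliqueCount (sphere G U x) j
  cliques-through U x j = begin
    sumBy (λ C → ind (lookup C x) ℕ.* cliqueOfSize U (suc j) C) S
      ≡⟨ sum-containing x (cliqueOfSize U (suc j)) ⟩
    sumBy (λ D → ind (not (lookup D x)) ℕ.* cliqueOfSize U (suc j) (D [ x ]≔ true)) S
      ≡⟨ sumBy-cong S cone ⟩
    sumBy (λ D → ind (lookup U x) ℕ.* cliqueOfSize (sphere G U x) j D) S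
      ≡⟨ sumBy-scale (ind (lookup U x)) (cliqueOfSize (sphere G U x) j) S ⟩
    ind (lookup U x) ℕ.* sumBy (cliqueOfSize (sphere G U x) j) S
      ≡⟨ cong (ind (lookup U x) ℕ.*_) (sym (cliqueCount-as-sum (sphere G U x) j)) ⟩
    ind (lookup U x) ℕ.* cliqueCount (sphere G U x) j ∎
    where
    open ≡-Reasoning
    S : List (Subset (n G))
    S = allSubsets (n G)
    cone : ∀ D → ind (not (lookup D x)) ℕ.* cliqueOfSize U (suc j) (D [ x ]≔ true) ≡
                 ind (lookup U x) ℕ.* cliqueOfSize (sphere G U x) j D
    cone D with lookup D x in Dx
    ... | true  rewrite sphere-clique-avoids U x D Dx = sym (ℕP.*-zeroʳ (ind (lookup U x)))
    ... | false with lookup U x in Ux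
    ...   | true  = cong₂ (λ b m → ind b ℕ.* ind (m ≡ᵇ suc j) ℕ.+ 0) (cone-clique U x D Ux Dx) (∣insert∣ x D Dx)
    ...   | false rewrite outside-clique U (D [ x ]≔ true) x Ux (VecP.lookup∘update x D true) = refl

  -- Gauss–Bonnet for clique counts: counting the pairs (x, C) with x ∈ C a clique of
  -- size j+1 in two ways,  (j+1)·c_(j+1)(U) = Σ_(x ∈ U) c_j(S(x)).
  gaussBonnet-count : ∀ U j →
    suc j ℕ.* cliqueCount U (suc j) ≡ sumBy (λ x → ind (lookup U x) ℕ.* cliqueCount (sphere G U x) j) (allFin (n G))
  gaussBonnet-count U j = begin
    suc j ℕ.* cliqueCount U (suc j)
      ≡⟨ cong (suc j ℕ.*_) (cliqueCount-as-sum U (suc j)) ⟩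
    suc j ℕ.* sumBy Q S
      ≡⟨ sym (sumBy-scale (suc j) Q S) ⟩
    sumBy (λ C → suc j ℕ.* Q C) S
      ≡⟨ sumBy-cong S (λ C → size-weight ∣ C ∣ j (ind (isCliqueᵇ G U C))) ⟩
    sumBy (λ C → ∣ C ∣ ℕ.* Q C) S
      ≡⟨ sumBy-cong S (λ C → trans (cong (ℕ._* Q C) (∣∣-as-sum C))
                                   (sumBy-scaleʳ (Q C) (λ x → ind (lookup C x)) (allFin (n G)))) ⟩
    sumBy (λ C → sumBy (λ x → ind (lookup C x) ℕ.* Q C) (allFin (n G))) S
      ≡⟨ sumBy-swap (λ C x → ind (lookup C x) ℕ.* Q C) S (allFin (n G)) ⟩
    sumBy (λ x → sumBy (λ C → ind (lookup C x) ℕ.* Q C) S) (allFin (n G))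
      ≡⟨ sumBy-cong (allFin (n G)) (λ x → cliques-through U x j) ⟩
    sumBy (λ x → ind (lookup U x) ℕ.* cliqueCount (sphere G U x) j) (allFin (n G)) ∎
    where
    open ≡-Reasoning
    S : List (Subset (n G))
    S = allSubsets (n G)
    Q : Subset (n G) → ℕ
    Q = cliqueOfSize U (suc j)

  fPoly : Subset (n G) → Poly
  fPoly U = map (λ j → + cliqueCount U j) (upTo (suc (n G)))

  coeff-fPoly : ∀ U j → coeff (fPoly U) j ≡ + cliqueCount U j
  coeff-fPoly U j = coeff-map-applyUpTo _ (λ k → k) (suc (n G)) j (λ n<j → cong +_ (cliqueCount-large U j n<j))

  coeff-fPoly-0 : ∀ U → coeff (fPoly U) 0 ≡ + 1
  coeff-fPoly-0 U = trans (coeff-fPoly U 0) (cong +_ (cliqueCount-zero U))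

  ev-fPoly : ∀ U t → ev (fPoly U) t ≡ + 1 + ∑< (n G) (λ k → + f G U k * t ^ suc k)
  ev-fPoly U t =
    trans (ev-map-applyUpTo (λ j → + cliqueCount U j) (λ k → k) (suc (n G)) t)
          (cong (λ c → + c * + 1 + ∑< (n G) (λ k → + f G U k * t ^ suc k)) (cliqueCount-zero U))

  pow≡^ : ∀ t k → pow G t k ≡ t ^ k
  pow≡^ t zero    = refl
  pow≡^ t (suc k) = cong (t *_) (pow≡^ t k)

  sgn≡^ : ∀ k → -[1+ 0 ] ^ k ≡ sgn G k
  sgn≡^ zero    = refl
  sgn≡^ (suc k) = trans (cong (-[1+ 0 ] *_) (sgn≡^ k)) (ℤP.-1*i≡-i (sgn G k))

  fpoly≡ev : ∀ U t → fpoly G U t ≡ ev (fPoly U) t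
  fpoly≡ev U t = begin
    fpoly G U t
      ≡⟨ cong (_+_ (+ 1)) (∑<-foldr (n G) (λ k → k) (λ k → + f G U k * pow G t (suc k))) ⟩
    + 1 + ∑< (n G) (λ k → + f G U k * pow G t (suc k))
      ≡⟨ cong (_+_ (+ 1)) (∑<-cong (n G) (λ k _ → cong (+ f G U k *_) (pow≡^ t (suc k)))) ⟩
    + 1 + ∑< (n G) (λ k → + f G U k * t ^ suc k)
      ≡⟨ sym (ev-fPoly U t) ⟩
    ev (fPoly U) t ∎
    where open ≡-Reasoning

  ev-fPoly-at-minus-one : ∀ U → ev (fPoly U) -[1+ 0 ] ≡ + 1 - χ G U
  ev-fPoly-at-minus-one U = begin
    ev (fPoly U) -[1+ 0 ]
      ≡⟨ ev-fPoly U -[1+ 0 ] ⟩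
    + 1 + ∑< (n G) (λ k → + f G U k * -[1+ 0 ] ^ suc k)
      ≡⟨ cong (_+_ (+ 1)) (∑<-cong (n G) (λ k _ → term k)) ⟩
    + 1 + ∑< (n G) (λ k → -[1+ 0 ] * (sgn G k * + f G U k))
      ≡⟨ cong (_+_ (+ 1)) (∑<-scale (n G) -[1+ 0 ] (λ k → sgn G k * + f G U k)) ⟩
    + 1 + -[1+ 0 ] * ∑< (n G) (λ k → sgn G k * + f G U k)
      ≡⟨ cong (λ c → + 1 + -[1+ 0 ] * c) (sym (∑<-foldr (n G) (λ k → k) (λ k → sgn G k * + f G U k))) ⟩
    + 1 + -[1+ 0 ] * χ G U
      ≡⟨ subtract (χ G U) ⟩
    + 1 - χ G U ∎
    where
    open ≡-Reasoning
    rearrange : ∀ a s → a * (-[1+ 0 ] * s) ≡ -[1+ 0 ] * (s * a)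
    rearrange = solve-∀
    subtract : ∀ x → + 1 + -[1+ 0 ] * x ≡ + 1 - x
    subtract = solve-∀
    term : ∀ k → + f G U k * -[1+ 0 ] ^ suc k ≡ -[1+ 0 ] * (sgn G k * + f G U k)
    term k = trans (cong (λ e → + f G U k * (-[1+ 0 ] * e)) (sgn≡^ k)) (rearrange (+ f G U k) (sgn G k))

  deg-fPoly : ∀ U → Deg≤ (fPoly U) (dim+1 G U)
  deg-fPoly U (suc k) D<1+k = trans (coeff-fPoly U (suc k)) (cong +_ no-cliques)
    where
    no-cliques : cliqueCount U (suc k) ≡ 0
    no-cliques with k ℕ.<? n G
    ... | yes k<n = zero-beyond-lastNonzero (f G U) (n G) k (ℕP.≤-pred D<1+k) k<n
    ... | no  k≮n = cliqueCount-large U (suc k) (s≤s (ℕP.≮⇒≥ k≮n))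

  top-fPoly : ∀ U → coeff (fPoly U) (dim+1 G U) ≢ + 0
  top-fPoly U top≡0 with lastNonzero-attained (f G U) (n G)
  ... | inj₁ D≡0 = case trans (sym (coeff-fPoly-0 U)) (subst (λ D → coeff (fPoly U) D ≡ + 0) D≡0 top≡0) of λ ()
  ... | inj₂ (k , D≡1+k , fk≢0) =
    fk≢0 (ℤP.+-injective (trans (sym (coeff-fPoly U (suc k)))
                                (subst (λ D → coeff (fPoly U) D ≡ + 0) D≡1+k top≡0)))

  sphereSum : Subset (n G) → Poly
  sphereSum U = ∑ₚ (λ x → if lookup U x then fPoly (sphere G U x) else []) (allFin (n G))

  gaussBonnet : ∀ U → der (fPoly U) ≈ₚ sphereSum U
  gaussBonnet U i = begin
    coeff (der (fPoly U)) i                  ≡⟨ coeff-der (fPoly U) i ⟩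
    + suc i * coeff (fPoly U) (suc i)        ≡⟨ cong (λ c → + suc i * c) (coeff-fPoly U (suc i)) ⟩
    + suc i * + cliqueCount U (suc i)      ≡⟨ sym (ℤP.pos-* (suc i) _) ⟩
    + (suc i ℕ.* cliqueCount U (suc i))    ≡⟨ cong +_ (gaussBonnet-count U i) ⟩
    + sumBy (λ x → ind (lookup U x) ℕ.* cliqueCount (sphere G U x) i) (allFin (n G))
      ≡⟨ sym (coeff-∑ₚ _ (allFin (n G)) i _ summand) ⟩
    coeff (sphereSum U) i                    ∎
    where
    open ≡-Reasoning
    summand : ∀ x → coeff (if lookup U x then fPoly (sphere G U x) else []) i ≡
                    + (ind (lookup U x) ℕ.* cliqueCount (sphere G U x) i)
    summand x with lookup U x
    ... | true  = trans (coeff-fPoly (sphere G U x) i) (cong +_ (sym (ℕP.+-identityʳ _)))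
    ... | false = refl

  sphereSum-FunEq : ∀ c U → (∀ x → lookup U x ≡ true → FunEq c (fPoly (sphere G U x))) →
    FunEq c (sphereSum U)
  sphereSum-FunEq c U spheres = FunEq-∑ₚ c _ (allFin (n G)) summand
    where
    summand : ∀ x → FunEq c (if lookup U x then fPoly (sphere G U x) else [])
    summand x with lookup U x in Ux
    ... | true  = spheres x Ux
    ... | false = FunEq-[] c

  fPoly-empty : ∀ U → (∀ x → lookup U x ≡ false) → fPoly U ≈ₚ (+ 1 ∷ [])
  fPoly-empty U empty zero    = coeff-fPoly-0 U
  fPoly-empty U empty (suc j) = trans (coeff-fPoly U (suc j)) (cong +_ no-cliques)
    where
    no-cliques : cliqueCount U (suc j) ≡ 0
    no-cliques with ℕP.m*n≡0⇒m≡0∨n≡0 (suc j)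
                      (trans (gaussBonnet-count U j)
                             (trans (sumBy-cong (allFin (n G))
                                                (λ x → cong (λ b → ind b ℕ.* cliqueCount (sphere G U x) j) (empty x)))
                                    (sumBy-zero (allFin (n G)))))
    ... | inj₂ c≡0 = c≡0

  -- Theorem 6 in functional-equation form, by induction on k: if G[U] ∈ 𝒳_(k-1), then
  -- f_U(t) + (-1)^(k-1)·f_U(-1-t) = 0.  The empty graph has f_U = 1.  In the inductive step
  -- f_U' = Σ f_(S(x)) satisfies the equation with the opposite sign by induction, and at
  -- t = -1 it reads 1 - χ + (-1)^(k-1) = 0, which is the Euler characteristic condition.
  functionalEquation : ∀ k U → 𝒳' G k U → FunEq (- sgn G k) (fPoly U)
  functionalEquation zero    U empty =
    FunEq-≈ -[1+ 0 ] (+ 1 ∷ []) (fPoly U) (λ i → sym (fPoly-empty U empty i)) constant-one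
    where
    constant-one : FunEq -[1+ 0 ] (+ 1 ∷ [])
    constant-one t = cancel t
      where
      cancel : ∀ t → (+ 1 + t * + 0) + -[1+ 0 ] * (+ 1 + (-[1+ 0 ] - t) * + 0) ≡ + 0
      cancel = solve-∀
  functionalEquation (suc k) U (euler , spheres) =
    FunEq-integrate s (fPoly U)
      (FunEq-≈ (- s) (sphereSum U) (der (fPoly U)) (λ i → sym (gaussBonnet U i))
               (sphereSum-FunEq (- s) U λ x Ux →
                  subst (λ c → FunEq c (fPoly (sphere G U x))) (sym (ℤP.neg-involutive (- sgn G k)))
                        (functionalEquation k (sphere G U x) (spheres x Ux))))
      at-minus-one
    where
    open ≡-Reasoning
    s : ℤ
    s = - sgn G (suc k)
    at-minus-one : ev (fPoly U) -[1+ 0 ] + s * ev (fPoly U) (+ 0) ≡ + 0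
    at-minus-one = begin
      ev (fPoly U) -[1+ 0 ] + s * ev (fPoly U) (+ 0)
        ≡⟨ cong₂ (λ a b → a + s * b) (ev-fPoly-at-minus-one U) (trans (ev-at-0 (fPoly U)) (coeff-fPoly-0 U)) ⟩
      (+ 1 - χ G U) + s * + 1               ≡⟨ cong (λ c → (+ 1 - c) + s * + 1) euler ⟩
      (+ 1 - (+ 1 + sgn G k)) + s * + 1     ≡⟨ cancel (sgn G k) ⟩
      + 0                                   ∎
      where
      cancel : ∀ e → (+ 1 - (+ 1 + e)) + - - e * + 1 ≡ + 0
      cancel = solve-∀

  sgnℤ≡sgn : ∀ k → sgnℤ (+ k) ≡ sgn G k
  sgnℤ≡sgn zero    = refl
  sgnℤ≡sgn (suc k) = cong -_ (sgnℤ≡sgn k)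

  FunEq-𝒳 : ∀ d U → 𝒳 G d U → FunEq (sgnℤ d) (fPoly U)
  FunEq-𝒳 (+ k)        U X =
    subst (λ c → FunEq c (fPoly U)) (trans (ℤP.neg-involutive (sgn G k)) (sym (sgnℤ≡sgn k)))
          (functionalEquation (suc k) U X)
  FunEq-𝒳 -[1+ zero ]  U X = functionalEquation zero U X
  FunEq-𝒳 -[1+ suc _ ] U ()

  dehnSommerville-and-FunEq : ∀ s U → FunEq s (fPoly U) →
    DehnSommerville G U × (∀ t → fpoly G U t + s * fpoly G U (-[1+ 0 ] - t) ≡ + 0)
  dehnSommerville-and-FunEq s U fe =
    hPolyOf-palindromic (dim+1 G U) s (λ k → + f G U k) (fPoly U) (deg-fPoly U) (top-fPoly U) fe
                        (coeff-fPoly-0 U) (λ k _ → coeff-fPoly U (suc k)) ,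
    λ t → trans (cong₂ (λ a b → a + s * b) (fpoly≡ev U t) (fpoly≡ev U (-[1+ 0 ] - t))) (fe t)

mainTheorem6 : (d : ℤ) → -[1+ 0 ] ≤ d → (G : Graph) → 𝒳 G d (V G) →
    DehnSommerville G (V G) ×
    (∀ (t : ℤ) → fpoly G (V G) t + sgnℤ d * fpoly G (V G) (-[1+ 0 ] - t) ≡ + 0)
mainTheorem6 d _ G X = dehnSommerville-and-FunEq G (sgnℤ d) (V G) (FunEq-𝒳 G d (V G) X)
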